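{- Let $X=\{x_1,\dots,x_n\}$ be positive integers with $\sum_{i=1}^n x_i=2B$, and let $I$ be the instance of $(1 \mid p\mathrm{MA} \mid \sum_j C_j)$ constructed from $X$ as described in the context. If there is a feasible schedule for $I$ with total completion time at most $Q=Q_0+B$, then there is a subset $X_1\subset X$ with $\sum_{x\in X_1}x=B$.
   Context: Problem $(1 \mid p\mathrm{MA} \mid \sum_j C_j)$: a single machine with maintenance level initially $\mathrm{ML}_0$ and maximum $\mathrm{ML}^{\max}$; each job $J_i$ has non-preemptive processing time $p_i$ and deterioration $\delta_i$, and processing it decreases the level by $\delta_i$; the level must never be negative; maintenance activities (MAs) of any duration $D\in[0,\mathrm{ML}^{\max}-\mathrm{ML}]$ ($\mathrm{ML}$ the current level) may be inserted, occupying the machine for time $D$ and raising the level by $D$. The objective is the total completion time $\sum_i C_i$. Construction of $I$ from $X$: there are $2n+3$ jobs $J_0,\dots,J_{2n+2}$. Fix an integer $M>(4n+8)B$. For $i=0,1,\dots,n$: $p_i=p_{n+1+i}=\sum_{j=1}^i x_j$ (so $p_0=0$) and $\delta_i=\delta_{n+1+i}=M-2p_i$. Also $p_{2n+2}=M-2B$, $\delta_{2n+2}=0$. The initial maintenance level is $\mathrm{ML}_0=\sum_{i=0}^n\delta_i-2B$ and the maximum maintenance level is $\mathrm{ML}^{\max}=\sum_{i=0}^n\delta_i$. Define $$Q_0=\sum_{j=0}^n(n-j+1)p_j+(n+2)\Big(\sum_{j=0}^np_j+2B+p_{2n+2}\Big)+\sum_{j=0}^n(j+1)(p_{n+1+j}+\delta_{n+1+j}),$$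 and $Q=Q_0+B$.
   Formalization: The feasible schedule in the hypothesis has only rational idle times and rational maintenance-activity durations. -}

module Defs where

open import Data.Nat as ℕ using (ℕ; zero; suc; _∸_; _≤ᵇ_; _<ᵇ_)
open import Data.Bool using (Bool; true; false; if_then_else_)
open import Data.Fin using (Fin; toℕ)
import Data.Fin
open import Data.Product using (_×_; _,_)
open import Data.Unit using (⊤)
open import Data.List using (List; []; _∷_; map)
open import Data.Integer using (+_)
open import Data.Rational using (ℚ; _+_; _-_; _≤_; 0ℚ; _/_)

ℕ→ℚ : ℕ → ℚ
ℕ→ℚ k = + k / 1

sumTo : ℕ → (ℕ → ℕ) → ℕ
sumTo zero    f = 0
sumTo (suc k) f = sumTo k f ℕ.+ f k

sumF : ∀ {k} → (Fin k → ℕ) → ℕ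
sumF {zero}  f = 0
sumF {suc k} f = f Data.Fin.zero ℕ.+ sumF (λ i → f (Data.Fin.suc i))

-- sum of the elements of a sub-family selected by S  (X₁ = {x_i | S i = true})
sumSel : ∀ {k} → (Fin k → ℕ) → (Fin k → Bool) → ℕ
sumSel x S = sumF (λ i → if S i then x i else 0)

-- The instance I built from X = (x₁,…,xₙ) (x i = x_{i+1}, 0-indexed), B, M

module Instance (n : ℕ) (x : Fin n → ℕ) (B M : ℕ) where

  pre : ℕ → ℕ
  pre i = sumF (λ j → if toℕ j <ᵇ i then x j else 0)

  pj : ℕ → ℕ
  pj t = if t ≤ᵇ n then pre t
         else if t ≤ᵇ 2 ℕ.* n ℕ.+ 1 then pre (t ∸ (n ℕ.+ 1))
         else M ∸ 2 ℕ.* B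

  δj : ℕ → ℕ
  δj t = if t ≤ᵇ 2 ℕ.* n ℕ.+ 1 then M ∸ 2 ℕ.* pj t else 0

  m : ℕ
  m = 2 ℕ.* n ℕ.+ 3

  p : Fin m → ℕ
  p j = pj (toℕ j)

  δ : Fin m → ℕ
  δ j = δj (toℕ j)

  MLmax : ℕ
  MLmax = sumTo (suc n) δj

  ML₀ : ℕ
  ML₀ = MLmax ∸ 2 ℕ.* B

  Q₀ : ℕ
  Q₀ = sumTo (suc n) (λ j → (n ∸ j ℕ.+ 1) ℕ.* pj j)
       ℕ.+ (n ℕ.+ 2) ℕ.* (sumTo (suc n) pj ℕ.+ 2 ℕ.* B ℕ.+ pj (2 ℕ.* n ℕ.+ 2))
       ℕ.+ sumTo (suc n) (λ j → (j ℕ.+ 1) ℕ.* (pj (n ℕ.+ 1 ℕ.+ j) ℕ.+ δj (n ℕ.+ 1 ℕ.+ j)))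

  Q : ℕ
  Q = Q₀ ℕ.+ B

-- A schedule is a list of steps (g , D , j): the machine idles for g ≥ 0,
-- then performs a maintenance activity of duration D (D = 0 means none;
-- several consecutive MAs are merged into one, which is equivalent), then
-- processes job j non-preemptively.

module Scheduling {m : ℕ} (p δ : Fin m → ℕ) (MLmax : ℕ) where

  Step : Set
  Step = ℚ × ℚ × Fin m

  job : Step → Fin m
  job (_ , _ , j) = j

  -- feasibility, starting at time t with maintenance level L
  FeasibleFrom : ℚ → ℚ → List Step → Set
  FeasibleFrom t L [] = ⊤
  FeasibleFrom t L ((g , D , j) ∷ s) =
    0ℚ ≤ g × 0ℚ ≤ D × D ≤ ℕ→ℚ MLmax - L
    × 0ℚ ≤ (L + D) - ℕ→ℚ (δ j)
    × FeasibleFrom (((t + g) + D) + ℕ→ℚ (p j)) ((L + D) - ℕ→ℚ (δ j)) s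

  TotalFrom : ℚ → List Step → ℚ
  TotalFrom t [] = 0ℚ
  TotalFrom t ((g , D , j) ∷ s) =
    C + TotalFrom C s
    where C = ((t + g) + D) + ℕ→ℚ (p j)

module Submission where

-- Along any schedule the k-th job completes no earlier than the processing of the first k
-- jobs plus the maintenance that their deterioration forces beyond ML₀. Split the job order
-- after n + 1 jobs. The jobs J_t and J_{n+1+t} (t ≤ n) have p = pre t and p + δ + pre t = M,
-- so the bound decomposes along X: with τᵢ the number of the first n + 1 jobs whose level
-- exceeds i and qᵢ = n − i, a packing argument on the positions of these jobs shows that the
-- i-th part exceeds its share of Q₀ by at least xᵢ(τᵢ − qᵢ)². The maintenance after the first
-- n + 1 jobs adds at least 2(B − Σᵢ xᵢ(τᵢ − qᵢ)), and the long job cannot come early. A total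
-- of at most Q₀ + B then forces τᵢ − qᵢ ∈ {0, 1} for all i and Σᵢ xᵢ(τᵢ − qᵢ) = B.

open import Data.Nat using (ℕ)
open import Data.Fin using (Fin)

module FinSums where
  open import Data.Nat using (ℕ; zero; suc; _+_; _*_; _≤_; _<_; z≤n)
  open import Data.Nat.Properties
  open import Algebra.Properties.CommutativeSemigroup +-commutativeSemigroup using (interchange)
  open import Data.Nat.ListAction using (sum)
  open import Data.Fin as Fin using (Fin; toℕ)
  open import Data.List using (tabulate)
  open import Function using (_∘_)
  open import Relation.Binary.PropositionalEquality
  open import Defs using (sumTo; sumF)

  record Linear {b} {B : Set b} (Λ : (B → ℕ) → ℕ) : Set b where
    field
      ext         : ∀ {f g} → (∀ j → f j ≡ g j) → Λ f ≡ Λ g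
      additive    : ∀ f g → Λ (λ j → f j + g j) ≡ Λ f + Λ g
      homogeneous : ∀ c f → Λ (λ j → c * f j) ≡ c * Λ f

  linear-sumF : ∀ {b} {B : Set b} {Λ : (B → ℕ) → ℕ} → Linear Λ →
                ∀ {k} (c : Fin k → ℕ) (g : Fin k → B → ℕ) →
                Λ (λ j → sumF (λ i → c i * g i j)) ≡ sumF (λ i → c i * Λ (g i))
  linear-sumF L {zero}  c g = Linear.homogeneous L 0 (λ _ → 0)
  linear-sumF L {suc k} c g = trans (Linear.additive L _ _)
    (cong₂ _+_ (Linear.homogeneous L (c Fin.zero) (g Fin.zero)) (linear-sumF L (c ∘ Fin.suc) (g ∘ Fin.suc)))

  sumF-cong : ∀ {k} {f g : Fin k → ℕ} → (∀ i → f i ≡ g i) → sumF f ≡ sumF g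
  sumF-cong {zero}  f≡g = refl
  sumF-cong {suc k} f≡g = cong₂ _+_ (f≡g Fin.zero) (sumF-cong (f≡g ∘ Fin.suc))

  sumF-+ : ∀ {k} (f g : Fin k → ℕ) → sumF (λ i → f i + g i) ≡ sumF f + sumF g
  sumF-+ {zero}  f g = refl
  sumF-+ {suc k} f g rewrite sumF-+ (f ∘ Fin.suc) (g ∘ Fin.suc) = interchange (f Fin.zero) (g Fin.zero) _ _

  sumF-* : ∀ {k} c (f : Fin k → ℕ) → sumF (λ i → c * f i) ≡ c * sumF f
  sumF-* {zero}  c f = sym (*-zeroʳ c)
  sumF-* {suc k} c f rewrite sumF-* c (f ∘ Fin.suc) = sym (*-distribˡ-+ c (f Fin.zero) _)

  sumF-mono : ∀ {k} {f g : Fin k → ℕ} → (∀ i → f i ≤ g i) → sumF f ≤ sumF g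
  sumF-mono {zero}  f≤g = z≤n
  sumF-mono {suc k} f≤g = +-mono-≤ (f≤g Fin.zero) (sumF-mono (f≤g ∘ Fin.suc))

  triangle : ℕ → ℕ
  triangle zero    = 0
  triangle (suc k) = suc k + triangle k

  sumTo-triangle : ∀ k → sumTo k (λ j → j + 1) ≡ triangle k
  sumTo-triangle zero    = refl
  sumTo-triangle (suc k) =
    trans (cong (_+ (k + 1)) (sumTo-triangle k)) (trans (+-comm (triangle k) (k + 1)) (cong (_+ triangle k) (+-comm k 1)))

  sum-tabulate : ∀ {k} (f : Fin k → ℕ) → sum (tabulate f) ≡ sumF f
  sum-tabulate {zero}  f = refl
  sum-tabulate {suc k} f = cong (f Fin.zero +_) (sum-tabulate (f ∘ Fin.suc))

  sumTo-cong : ∀ k {f g : ℕ → ℕ} → (∀ j → j < k → f j ≡ g j) → sumTo k f ≡ sumTo k g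
  sumTo-cong zero    f≡g = refl
  sumTo-cong (suc k) f≡g = cong₂ _+_ (sumTo-cong k (λ j j<k → f≡g j (m<n⇒m<1+n j<k))) (f≡g k (n<1+n k))

  sumTo-+ : ∀ k (f g : ℕ → ℕ) → sumTo k (λ i → f i + g i) ≡ sumTo k f + sumTo k g
  sumTo-+ zero    f g = refl
  sumTo-+ (suc k) f g rewrite sumTo-+ k f g = interchange (sumTo k f) (sumTo k g) (f k) (g k)

  sumTo-* : ∀ k c (f : ℕ → ℕ) → sumTo k (λ i → c * f i) ≡ c * sumTo k f
  sumTo-* zero    c f = sym (*-zeroʳ c)
  sumTo-* (suc k) c f rewrite sumTo-* k c f = sym (*-distribˡ-+ c _ (f k))

  sumTo-linear : ∀ k → Linear (sumTo k)
  sumTo-linear k = record { ext = λ f≡g → sumTo-cong k (λ j _ → f≡g j) ; additive = sumTo-+ k ; homogeneous = sumTo-* k }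

  sumTo-const : ∀ k c → sumTo k (λ _ → c) ≡ k * c
  sumTo-const zero    c = refl
  sumTo-const (suc k) c rewrite sumTo-const k c = +-comm (k * c) c

  sumTo-++ : ∀ a b (g : ℕ → ℕ) → sumTo (a + b) g ≡ sumTo a g + sumTo b (λ k → g (a + k))
  sumTo-++ a zero    g rewrite +-identityʳ a = sym (+-identityʳ _)
  sumTo-++ a (suc b) g rewrite +-suc a b | sumTo-++ a b g = +-assoc (sumTo a g) _ _

  sumTo-suc : ∀ k (g : ℕ → ℕ) → sumTo (suc k) g ≡ g 0 + sumTo k (g ∘ suc)
  sumTo-suc zero    g = +-comm 0 (g 0)
  sumTo-suc (suc k) g rewrite sumTo-suc k g = +-assoc (g 0) _ _

  sumF-toℕ : ∀ k (g : ℕ → ℕ) → sumF {k} (g ∘ toℕ) ≡ sumTo k g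
  sumF-toℕ zero    g = refl
  sumF-toℕ (suc k) g = trans (cong (g 0 +_) (sumF-toℕ k (g ∘ suc))) (sym (sumTo-suc k g))

module ListSums {a} {A : Set a} where
  open import Data.Nat using (ℕ; suc; _+_; _*_; _≤_; z≤n; s≤s)
  open import Data.Nat.Properties
  open import Algebra.Properties.CommutativeSemigroup +-commutativeSemigroup using (interchange)
  open import Data.Nat.ListAction using (sum)
  open import Data.Nat.Tactic.RingSolver using (solve-∀)
  open import Data.List using (List; []; _∷_; map; length)
  open import Data.Sum using (_⊎_; inj₁; inj₂)
  open import Relation.Binary.PropositionalEquality
  open FinSums using (Linear; triangle)

  -- prefixSums h [a₁, …, a_L] = Σₖ (h a₁ + ⋯ + h aₖ) = Σₖ (L + 1 − k) · h aₖ
  prefixSums : (A → ℕ) → List A → ℕ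
  prefixSums h []      = 0
  prefixSums h (j ∷ l) = suc (length l) * h j + prefixSums h l

  -- positionalSum h [a₁, …, a_L] = Σₖ k · h aₖ
  positionalSum : (A → ℕ) → List A → ℕ
  positionalSum h []      = 0
  positionalSum h (j ∷ l) = h j + positionalSum h l + sum (map h l)

  sum-map-linear : (l : List A) → Linear (λ h → sum (map h l))
  sum-map-linear l = record { ext = λ f≡g → ext f≡g l ; additive = additive l ; homogeneous = homogeneous l }
    where
    ext : ∀ {f g : A → ℕ} → (∀ j → f j ≡ g j) → (l : List A) → sum (map f l) ≡ sum (map g l)
    ext f≡g []      = refl
    ext f≡g (j ∷ l) = cong₂ _+_ (f≡g j) (ext f≡g l)
    additive : (l : List A) (f g : A → ℕ) → sum (map (λ j → f j + g j) l) ≡ sum (map f l) + sum (map g l)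
    additive []      f g = refl
    additive (j ∷ l) f g rewrite additive l f g = interchange (f j) (g j) _ _
    homogeneous : (l : List A) (c : ℕ) (f : A → ℕ) → sum (map (λ j → c * f j) l) ≡ c * sum (map f l)
    homogeneous []      c f = sym (*-zeroʳ c)
    homogeneous (j ∷ l) c f rewrite homogeneous l c f = sym (*-distribˡ-+ c (f j) _)

  prefixSums-linear : (l : List A) → Linear (λ h → prefixSums h l)
  prefixSums-linear l = record { ext = λ f≡g → ext f≡g l ; additive = additive l ; homogeneous = homogeneous l }
    where
    ext : ∀ {f g : A → ℕ} → (∀ j → f j ≡ g j) → (l : List A) → prefixSums f l ≡ prefixSums g l
    ext f≡g []      = refl
    ext f≡g (j ∷ l) = cong₂ (λ a b → suc (length l) * a + b) (f≡g j) (ext f≡g l)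
    additive : (l : List A) (f g : A → ℕ) → prefixSums (λ j → f j + g j) l ≡ prefixSums f l + prefixSums g l
    additive []      f g = refl
    additive (j ∷ l) f g rewrite additive l f g | *-distribˡ-+ (suc (length l)) (f j) (g j) =
      interchange (suc (length l) * f j) (suc (length l) * g j) (prefixSums f l) (prefixSums g l)
    homogeneous : (l : List A) (c : ℕ) (f : A → ℕ) → prefixSums (λ j → c * f j) l ≡ c * prefixSums f l
    homogeneous []      c f = sym (*-zeroʳ c)
    homogeneous (j ∷ l) c f rewrite homogeneous l c f = distrib (suc (length l)) c (f j) _
      where
      distrib : ∀ L c a P → L * (c * a) + c * P ≡ c * (L * a + P)
      distrib = solve-∀

  positionalSum-linear : (l : List A) → Linear (λ h → positionalSum h l)
  positionalSum-linear l = record { ext = λ f≡g → ext f≡g l ; additive = additive l ; homogeneous = homogeneous l }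
    where
    Σ : (l : List A) → Linear (λ h → sum (map h l))
    Σ = sum-map-linear
    ext : ∀ {f g : A → ℕ} → (∀ j → f j ≡ g j) → (l : List A) → positionalSum f l ≡ positionalSum g l
    ext f≡g []      = refl
    ext f≡g (j ∷ l) = cong₂ _+_ (cong₂ _+_ (f≡g j) (ext f≡g l)) (Linear.ext (Σ l) f≡g)
    additive : (l : List A) (f g : A → ℕ) → positionalSum (λ j → f j + g j) l ≡ positionalSum f l + positionalSum g l
    additive []      f g = refl
    additive (j ∷ l) f g rewrite additive l f g | Linear.additive (Σ l) f g = regroup (f j) (g j) _ _ _ _
      where
      regroup : ∀ a b c d x y → (a + b + (c + d)) + (x + y) ≡ (a + c + x) + (b + d + y)
      regroup = solve-∀
    homogeneous : (l : List A) (c : ℕ) (f : A → ℕ) → positionalSum (λ j → c * f j) l ≡ c * positionalSum f l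
    homogeneous []      c f = sym (*-zeroʳ c)
    homogeneous (j ∷ l) c f rewrite homogeneous l c f | Linear.homogeneous (Σ l) c f = distrib c (f j) _ _
      where
      distrib : ∀ c a W s → c * a + c * W + c * s ≡ c * (a + W + s)
      distrib = solve-∀

  sum-map-const : ∀ c (l : List A) → sum (map (λ _ → c) l) ≡ c * length l
  sum-map-const c []      = sym (*-zeroʳ c)
  sum-map-const c (j ∷ l) = trans (cong (c +_) (sum-map-const c l)) (sym (*-suc c (length l)))

  prefixSums-const : ∀ c (l : List A) → prefixSums (λ _ → c) l ≡ c * triangle (length l)
  prefixSums-const c []      = sym (*-zeroʳ c)
  prefixSums-const c (j ∷ l) rewrite prefixSums-const c l = distrib (length l) c (triangle (length l))
    where
    distrib : ∀ L c t → suc L * c + c * t ≡ c * (suc L + t)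
    distrib = solve-∀

  sum-map-complement : ∀ {f g : A → ℕ} c → (∀ j → f j + g j ≡ c) →
                       (l : List A) → sum (map f l) + sum (map g l) ≡ c * length l
  sum-map-complement {f} {g} c f+g≡c l = trans (sym (Linear.additive (sum-map-linear l) f g))
    (trans (Linear.ext (sum-map-linear l) f+g≡c) (sum-map-const c l))

  prefixSums-complement : ∀ {f g : A → ℕ} c → (∀ j → f j + g j ≡ c) →
                          (l : List A) → prefixSums f l + prefixSums g l ≡ c * triangle (length l)
  prefixSums-complement {f} {g} c f+g≡c l = trans (sym (Linear.additive (prefixSums-linear l) f g))
    (trans (Linear.ext (prefixSums-linear l) f+g≡c) (prefixSums-const c l))

  prefixSums+positionalSum : ∀ h (l : List A) → prefixSums h l + positionalSum h l ≡ suc (length l) * sum (map h l)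
  prefixSums+positionalSum h []      = refl
  prefixSums+positionalSum h (j ∷ l) =
    trans (regroup (length l) (h j) (prefixSums h l) (positionalSum h l) (sum (map h l)))
      (trans (cong (λ z → suc (length l) * h j + h j + z + sum (map h l)) (prefixSums+positionalSum h l))
        (collect (length l) (h j) (sum (map h l))))
    where
    regroup : ∀ L a P W s → (suc L * a + P) + (a + W + s) ≡ suc L * a + a + (P + W) + s
    regroup = solve-∀
    collect : ∀ L a s → suc L * a + a + suc L * s + s ≡ suc (suc L) * (a + s)
    collect = solve-∀

  sum-map≤prefixSums : ∀ h (l : List A) → sum (map h l) ≤ prefixSums h l
  sum-map≤prefixSums h []      = z≤n
  sum-map≤prefixSums h (j ∷ l) = +-mono-≤ (m≤n*m (h j) (suc (length l))) (sum-map≤prefixSums h l)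

  sum-map≤length : ∀ h → (∀ j → h j ≤ 1) → (l : List A) → sum (map h l) ≤ length l
  sum-map≤length h h≤1 []      = z≤n
  sum-map≤length h h≤1 (j ∷ l) = +-mono-≤ (h≤1 j) (sum-map≤length h h≤1 l)

  sum-map-gap : ∀ h K → (∀ j → h j ≡ 0 ⊎ h j ≡ K) → (l : List A) → sum (map h l) ≡ 0 ⊎ K ≤ sum (map h l)
  sum-map-gap h K h∈0K []      = inj₁ refl
  sum-map-gap h K h∈0K (j ∷ l) with h j | h∈0K j | sum-map-gap h K h∈0K l
  ... | _ | inj₂ refl | _          = inj₂ (m≤m+n K _)
  ... | _ | inj₁ refl | inj₁ Σ≡0   = inj₁ Σ≡0
  ... | _ | inj₁ refl | inj₂ K≤Σ   = inj₂ K≤Σ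

  -- A 0/1-valued h with τ ones among L places: the τ ones contribute at most
  -- L + (L − 1) + ⋯ + (L − τ + 1) to either weighted sum.
  prefixSums-packing : ∀ h → (∀ j → h j ≤ 1) → (l : List A) →
    2 * prefixSums h l + sum (map h l) * sum (map h l) ≤ sum (map h l) * (2 * length l + 1)
  prefixSums-packing h h≤1 [] = z≤n
  prefixSums-packing h h≤1 (j ∷ l) with h j | h≤1 j | prefixSums-packing h h≤1 l
  ... | 0 | _ | ih = begin
      2 * (suc L * 0 + P) + s * s ≡⟨ cong (λ z → 2 * (z + P) + s * s) (*-zeroʳ (suc L)) ⟩
      2 * P + s * s               ≤⟨ ih ⟩
      s * (2 * L + 1)             ≤⟨ *-monoʳ-≤ s (+-monoˡ-≤ 1 (*-monoʳ-≤ 2 (n≤1+n L))) ⟩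
      s * (2 * suc L + 1)         ∎
    where
    open ≤-Reasoning
    L = length l
    P = prefixSums h l
    s = sum (map h l)
  ... | 1 | _ | ih = begin
      2 * (suc L * 1 + P) + suc s * suc s         ≡⟨ split L P s ⟩
      (2 * P + s * s) + (2 * L + 2 * s + 3)       ≤⟨ +-monoˡ-≤ _ ih ⟩
      s * (2 * L + 1) + (2 * L + 2 * s + 3)       ≡⟨ collect L s ⟩
      suc s * (2 * suc L + 1)                     ∎
    where
    open ≤-Reasoning
    L = length l
    P = prefixSums h l
    s = sum (map h l)
    split : ∀ L P s → 2 * (suc L * 1 + P) + suc s * suc s ≡ (2 * P + s * s) + (2 * L + 2 * s + 3)
    split = solve-∀
    collect : ∀ L s → s * (2 * L + 1) + (2 * L + 2 * s + 3) ≡ suc s * (2 * suc L + 1)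
    collect = solve-∀
  ... | suc (suc _) | s≤s () | _

  positionalSum-packing : ∀ h → (∀ j → h j ≤ 1) → (l : List A) →
    2 * positionalSum h l + sum (map h l) * sum (map h l) ≤ sum (map h l) * (2 * length l + 1)
  positionalSum-packing h h≤1 [] = z≤n
  positionalSum-packing h h≤1 (j ∷ l) with h j | h≤1 j | positionalSum-packing h h≤1 l
  ... | 0 | _ | ih = begin
      2 * (W + s) + s * s              ≡⟨ split W s ⟩
      (2 * W + s * s) + 2 * s          ≤⟨ +-monoˡ-≤ _ ih ⟩
      s * (2 * L + 1) + 2 * s          ≡⟨ collect L s ⟩
      s * (2 * suc L + 1)              ∎
    where
    open ≤-Reasoning
    L = length l
    W = positionalSum h l
    s = sum (map h l)
    split : ∀ W s → 2 * (W + s) + s * s ≡ (2 * W + s * s) + 2 * s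
    split = solve-∀
    collect : ∀ L s → s * (2 * L + 1) + 2 * s ≡ s * (2 * suc L + 1)
    collect = solve-∀
  ... | 1 | _ | ih = begin
      2 * (1 + W + s) + suc s * suc s                 ≡⟨ split W s ⟩
      (2 * W + s * s) + (2 * s + 2 * s + 3)           ≤⟨ +-mono-≤ ih (+-monoˡ-≤ 3 (+-monoˡ-≤ (2 * s) (*-monoʳ-≤ 2 s≤L))) ⟩
      s * (2 * L + 1) + (2 * L + 2 * s + 3)           ≡⟨ collect L s ⟩
      suc s * (2 * suc L + 1)                         ∎
    where
    open ≤-Reasoning
    L = length l
    W = positionalSum h l
    s = sum (map h l)
    s≤L : s ≤ L
    s≤L = sum-map≤length h h≤1 l
    split : ∀ W s → 2 * (1 + W + s) + suc s * suc s ≡ (2 * W + s * s) + (2 * s + 2 * s + 3)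
    split = solve-∀
    collect : ∀ L s → s * (2 * L + 1) + (2 * L + 2 * s + 3) ≡ suc s * (2 * suc L + 1)
    collect = solve-∀
  ... | suc (suc _) | s≤s () | _

module ForcedCost {m : ℕ} (p δ : Fin m → ℕ) (ML₀ : ℕ) where
  open import Data.Nat using (ℕ; suc; _+_; _*_; _∸_; _≤_)
  open import Data.Nat.Properties
  open import Data.Nat.ListAction using (sum)
  open import Data.Nat.Tactic.RingSolver using (solve-∀)
  open import Data.Fin using (Fin)
  open import Data.List using (List; []; _∷_; map; length; _++_)
  open import Relation.Binary.PropositionalEquality
  open ListSums

  -- After processing P and deterioration Δ, the next job completes no earlier than the
  -- processing so far plus the maintenance needed to absorb the deterioration beyond ML₀.
  forcedCost : ℕ → ℕ → List (Fin m) → ℕ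
  forcedCost P Δ []       = 0
  forcedCost P Δ (j ∷ js) = (P + p j) + ((Δ + δ j) ∸ ML₀) + forcedCost (P + p j) (Δ + δ j) js

  forcedCost-++ : ∀ P Δ a b →
    forcedCost P Δ (a ++ b) ≡ forcedCost P Δ a + forcedCost (P + sum (map p a)) (Δ + sum (map δ a)) b
  forcedCost-++ P Δ []      b rewrite +-identityʳ P | +-identityʳ Δ = refl
  forcedCost-++ P Δ (j ∷ a) b
    rewrite forcedCost-++ (P + p j) (Δ + δ j) a b | +-assoc P (p j) (sum (map p a)) | +-assoc Δ (δ j) (sum (map δ a)) =
    sym (+-assoc (P + p j + ((Δ + δ j) ∸ ML₀)) _ _)

  forcedCost-≥-prefixSums : ∀ P Δ j l →
    length (j ∷ l) * P + prefixSums p (j ∷ l) + ((Δ + sum (map δ (j ∷ l))) ∸ ML₀) ≤ forcedCost P Δ (j ∷ l)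
  forcedCost-≥-prefixSums P Δ j [] rewrite +-identityʳ (δ j) = ≤-reflexive (identity P (p j) ((Δ + δ j) ∸ ML₀))
    where
    identity : ∀ P a X → 1 * P + (1 * a + 0) + X ≡ P + a + X + 0
    identity = solve-∀
  forcedCost-≥-prefixSums P Δ j (j′ ∷ l) = begin
      suc L * P + (suc L * p j + prefixSums p (j′ ∷ l)) + ((Δ + (δ j + sum (map δ (j′ ∷ l)))) ∸ ML₀)
        ≡⟨ cong (λ z → suc L * P + (suc L * p j + prefixSums p (j′ ∷ l)) + (z ∸ ML₀)) (sym (+-assoc Δ (δ j) _)) ⟩
      suc L * P + (suc L * p j + prefixSums p (j′ ∷ l)) + X
        ≡⟨ regroup L P (p j) (prefixSums p (j′ ∷ l)) X ⟩
      (P + p j) + (L * (P + p j) + prefixSums p (j′ ∷ l) + X)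
        ≤⟨ +-mono-≤ (m≤m+n (P + p j) _) (forcedCost-≥-prefixSums (P + p j) (Δ + δ j) j′ l) ⟩
      forcedCost P Δ (j ∷ j′ ∷ l) ∎
    where
    open ≤-Reasoning
    L = length (j′ ∷ l)
    X = (Δ + δ j + sum (map δ (j′ ∷ l))) ∸ ML₀
    regroup : ∀ L P a R X → suc L * P + (suc L * a + R) + X ≡ (P + a) + (L * (P + a) + R + X)
    regroup = solve-∀

  forcedCost-from-start : ∀ l → prefixSums p l + (sum (map δ l) ∸ ML₀) ≤ forcedCost 0 0 l
  forcedCost-from-start []      = ≤-reflexive (0∸n≡0 ML₀)
  forcedCost-from-start (j ∷ l) =
    subst (λ z → z + prefixSums p (j ∷ l) + (sum (map δ (j ∷ l)) ∸ ML₀) ≤ forcedCost 0 0 (j ∷ l))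
          (*-zeroʳ (length (j ∷ l))) (forcedCost-≥-prefixSums 0 0 j l)

  private
    +-∸-≤ : ∀ a b c → (a + b) ∸ c ≤ a + (b ∸ c)
    +-∸-≤ a b c = m≤n+o⇒m∸n≤o (a + b) c (begin
      a + b             ≤⟨ +-monoʳ-≤ a (m≤n+m∸n b c) ⟩
      a + (c + (b ∸ c)) ≡⟨ +-comm-assoc a c (b ∸ c) ⟩
      c + (a + (b ∸ c)) ∎)
      where
      open ≤-Reasoning
      +-comm-assoc : ∀ a c d → a + (c + d) ≡ c + (a + d)
      +-comm-assoc = solve-∀

  forcedCost-≥-excess : ∀ P Δ E l → P + Δ ≡ ML₀ + E →
    length l * E + prefixSums (λ j → p j + δ j) l ≤ forcedCost P Δ l
  forcedCost-≥-excess P Δ E []      _     = ≤-refl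
  forcedCost-≥-excess P Δ E (j ∷ l) P+Δ≡ = begin
      suc L * E + (suc L * (p j + δ j) + R)
        ≡⟨ regroup L E (p j) (δ j) R ⟩
      (p j + (E + δ j)) + (L * (E + (p j + δ j)) + R)
        ≤⟨ +-mono-≤ (+-monoʳ-≤ (p j) head-bound) (forcedCost-≥-excess (P + p j) (Δ + δ j) (E + (p j + δ j)) l shifted) ⟩
      (p j + (P + ((Δ + δ j) ∸ ML₀))) + forcedCost (P + p j) (Δ + δ j) l
        ≡⟨ cong (_+ forcedCost (P + p j) (Δ + δ j) l) (swap (p j) P _) ⟩
      forcedCost P Δ (j ∷ l) ∎
    where
    open ≤-Reasoning
    L = length l
    R = prefixSums (λ j → p j + δ j) l
    regroup : ∀ L E a d R → suc L * E + (suc L * (a + d) + R) ≡ (a + (E + d)) + (L * (E + (a + d)) + R)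
    regroup = solve-∀
    swap : ∀ a P c → a + (P + c) ≡ P + a + c
    swap = solve-∀
    head-bound : E + δ j ≤ P + ((Δ + δ j) ∸ ML₀)
    head-bound = begin
      E + δ j                  ≡⟨ sym (m+n∸m≡n ML₀ (E + δ j)) ⟩
      (ML₀ + (E + δ j)) ∸ ML₀  ≡⟨ cong (_∸ ML₀) (trans (sym (+-assoc ML₀ E (δ j))) (cong (_+ δ j) (sym P+Δ≡))) ⟩
      (P + Δ + δ j) ∸ ML₀      ≡⟨ cong (_∸ ML₀) (+-assoc P Δ (δ j)) ⟩
      (P + (Δ + δ j)) ∸ ML₀    ≤⟨ +-∸-≤ P (Δ + δ j) ML₀ ⟩
      P + ((Δ + δ j) ∸ ML₀)    ∎
    shifted : P + p j + (Δ + δ j) ≡ ML₀ + (E + (p j + δ j))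
    shifted = trans (regroup′ P (p j) Δ (δ j)) (trans (cong (_+ (p j + δ j)) P+Δ≡) (+-assoc ML₀ E _))
      where
      regroup′ : ∀ P a Δ d → P + a + (Δ + d) ≡ (P + Δ) + (a + d)
      regroup′ = solve-∀

module CompletionTimes where
  open import Data.Nat as ℕ using (ℕ)
  import Data.Nat.Properties as ℕ
  import Data.Nat.Coprimality as Coprimality
  open import Data.Integer as ℤ using (+_)
  import Data.Integer.Properties as ℤ
  open import Data.Rational
  open import Data.Rational.Properties
  open import Data.Rational.Solver using (module +-*-Solver)
  open +-*-Solver
  open import Data.Fin using (Fin)
  open import Data.List using (List; []; _∷_; map)
  open import Data.Product using (_,_)
  open import Data.Sum using (inj₁; inj₂)
  open import Relation.Binary.PropositionalEquality
  open import Defs using (ℕ→ℚ; module Scheduling)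

  ℕ→ℚ-mkℚ : ∀ k → ℕ→ℚ k ≡ mkℚ (+ k) 0 (Coprimality.sym (Coprimality.1-coprimeTo k))
  ℕ→ℚ-mkℚ k = normalize-coprime (Coprimality.sym (Coprimality.1-coprimeTo k))

  ℕ→ℚ-+ : ∀ a b → ℕ→ℚ (a ℕ.+ b) ≡ ℕ→ℚ a + ℕ→ℚ b
  ℕ→ℚ-+ a b rewrite ℕ→ℚ-mkℚ a | ℕ→ℚ-mkℚ b =
    /-cong (sym (cong₂ ℤ._+_ (ℤ.*-identityʳ (+ a)) (ℤ.*-identityʳ (+ b)))) refl

  ℕ→ℚ-cancel-≤ : ∀ {a b} → ℕ→ℚ a ≤ ℕ→ℚ b → a ℕ.≤ b
  ℕ→ℚ-cancel-≤ {a} {b} a≤b rewrite ℕ→ℚ-mkℚ a | ℕ→ℚ-mkℚ b with drop-*≤* a≤b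
  ... | a*1≤b*1 rewrite ℤ.*-identityʳ (+ a) | ℤ.*-identityʳ (+ b) = ℤ.drop‿+≤+ a*1≤b*1

  x≤x+nonNeg : ∀ x {y} → 0ℚ ≤ y → x ≤ x + y
  x≤x+nonNeg x 0≤y = ≤-trans (≤-reflexive (sym (+-identityʳ x))) (+-monoʳ-≤ x 0≤y)

  module _ {m : ℕ} (p δ : Fin m → ℕ) (MLmax ML₀ : ℕ) where
    open Scheduling p δ MLmax
    open ForcedCost p δ ML₀

    -- Invariant: by time t, the processing P and the maintenance L + Δ − ML₀ have been done.
    TotalFrom-≥-forcedCost : ∀ s t L P Δ → FeasibleFrom t L s →
      ℕ→ℚ P ≤ t → ℕ→ℚ P + L + ℕ→ℚ Δ ≤ t + ℕ→ℚ ML₀ →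
      ℕ→ℚ (forcedCost P Δ (map job s)) ≤ TotalFrom t s
    TotalFrom-≥-forcedCost []                t L P Δ _ _ _ = ≤-refl
    TotalFrom-≥-forcedCost ((g , D , j) ∷ s) t L P Δ (0≤g , 0≤D , _ , 0≤L′ , feasible) P≤t invariant =
      begin
        ℕ→ℚ (P′ ℕ.+ (Δ′ ℕ.∸ ML₀) ℕ.+ forcedCost P′ Δ′ (map job s))
          ≡⟨ ℕ→ℚ-+ (P′ ℕ.+ (Δ′ ℕ.∸ ML₀)) _ ⟩
        ℕ→ℚ (P′ ℕ.+ (Δ′ ℕ.∸ ML₀)) + ℕ→ℚ (forcedCost P′ Δ′ (map job s))
          ≤⟨ +-mono-≤ completion-bound (TotalFrom-≥-forcedCost s C L′ P′ Δ′ feasible P′≤C invariant′) ⟩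
        C + TotalFrom C s ∎
      where
      open ≤-Reasoning
      P′ = P ℕ.+ p j
      Δ′ = Δ ℕ.+ δ j
      C  = t + g + D + ℕ→ℚ (p j)
      L′ = L + D - ℕ→ℚ (δ j)
      ML = ℕ→ℚ ML₀

      t≤t+g : t ≤ t + g
      t≤t+g = x≤x+nonNeg t 0≤g

      P′≤C : ℕ→ℚ P′ ≤ C
      P′≤C = begin
        ℕ→ℚ P′              ≡⟨ ℕ→ℚ-+ P (p j) ⟩
        ℕ→ℚ P + ℕ→ℚ (p j)  ≤⟨ +-monoˡ-≤ (ℕ→ℚ (p j)) (≤-trans P≤t (≤-trans t≤t+g (x≤x+nonNeg (t + g) 0≤D))) ⟩
        C                   ∎

      invariant′ : ℕ→ℚ P′ + L′ + ℕ→ℚ Δ′ ≤ C + ML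
      invariant′ = begin
        ℕ→ℚ P′ + L′ + ℕ→ℚ Δ′
          ≡⟨ cong₂ (λ a b → a + L′ + b) (ℕ→ℚ-+ P (p j)) (ℕ→ℚ-+ Δ (δ j)) ⟩
        ℕ→ℚ P + ℕ→ℚ (p j) + L′ + (ℕ→ℚ Δ + ℕ→ℚ (δ j))
          ≡⟨ before (ℕ→ℚ P) (ℕ→ℚ (p j)) L D (ℕ→ℚ (δ j)) (ℕ→ℚ Δ) ⟩
        (ℕ→ℚ P + L + ℕ→ℚ Δ) + D + ℕ→ℚ (p j)
          ≤⟨ +-monoˡ-≤ (ℕ→ℚ (p j)) (+-monoˡ-≤ D invariant) ⟩
        (t + ML) + D + ℕ→ℚ (p j)
          ≡⟨ after t ML D (ℕ→ℚ (p j)) ⟩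
        (t + D + ℕ→ℚ (p j)) + ML
          ≤⟨ +-monoˡ-≤ ML (+-monoˡ-≤ (ℕ→ℚ (p j)) (+-monoˡ-≤ D t≤t+g)) ⟩
        C + ML ∎
        where
        before : ∀ P a L D d Δ → P + a + (L + D - d) + (Δ + d) ≡ (P + L + Δ) + D + a
        before = solve 6 (λ P a L D d Δ → P :+ a :+ (L :+ D :- d) :+ (Δ :+ d) := (P :+ L :+ Δ) :+ D :+ a) refl
        after : ∀ t ML D a → (t + ML) + D + a ≡ (t + D + a) + ML
        after = solve 4 (λ t ML D a → (t :+ ML) :+ D :+ a := (t :+ D :+ a) :+ ML) refl

      completion-bound : ℕ→ℚ (P′ ℕ.+ (Δ′ ℕ.∸ ML₀)) ≤ C
      completion-bound with ℕ.≤-total Δ′ ML₀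
      ... | inj₁ Δ′≤ML₀ rewrite ℕ.m≤n⇒m∸n≡0 Δ′≤ML₀ | ℕ.+-identityʳ P′ = P′≤C
      ... | inj₂ ML₀≤Δ′ = begin
        ℕ→ℚ (P′ ℕ.+ X)                   ≡⟨ ℕ→ℚ-+ P′ X ⟩
        ℕ→ℚ P′ + ℕ→ℚ X                   ≡⟨ cancel (ℕ→ℚ P′) (ℕ→ℚ X) ML ⟩
        ℕ→ℚ P′ + (ML + ℕ→ℚ X) - ML       ≤⟨ +-monoˡ-≤ (- ML) (+-monoˡ-≤ (ML + ℕ→ℚ X) P′≤P′+L′) ⟩
        ℕ→ℚ P′ + L′ + (ML + ℕ→ℚ X) - ML  ≡⟨ cong (λ z → ℕ→ℚ P′ + L′ + z - ML) (sym Δ′≡ML+X) ⟩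
        ℕ→ℚ P′ + L′ + ℕ→ℚ Δ′ - ML        ≤⟨ +-monoˡ-≤ (- ML) invariant′ ⟩
        C + ML - ML                      ≡⟨ +-cancel C ML ⟩
        C                                ∎
        where
        X = Δ′ ℕ.∸ ML₀
        P′≤P′+L′ : ℕ→ℚ P′ ≤ ℕ→ℚ P′ + L′
        P′≤P′+L′ = x≤x+nonNeg (ℕ→ℚ P′) 0≤L′
        Δ′≡ML+X : ℕ→ℚ Δ′ ≡ ML + ℕ→ℚ X
        Δ′≡ML+X = trans (cong ℕ→ℚ (sym (ℕ.m+[n∸m]≡n ML₀≤Δ′))) (ℕ→ℚ-+ ML₀ X)
        cancel : ∀ P X ML → P + X ≡ P + (ML + X) - ML
        cancel = solve 3 (λ P X ML → P :+ X := P :+ (ML :+ X) :- ML) refl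
        +-cancel : ∀ C ML → C + ML - ML ≡ C
        +-cancel = solve 2 (λ C ML → C :+ ML :- ML := C) refl

module Iverson where
  open import Data.Nat using (ℕ; zero; suc; _+_; _*_; _∸_; _≤_; _<_; z≤n; s≤s; s≤s⁻¹; _<ᵇ_; _≤ᵇ_)
  open import Data.Nat.Properties
  open import Data.Nat.Tactic.RingSolver using (solve-∀)
  open import Data.Bool using (Bool; true; false; if_then_else_)
  open import Relation.Nullary using (yes; no; contradiction)
  open import Relation.Nullary.Reflects using (ofʸ; ofⁿ)
  open import Relation.Binary.PropositionalEquality hiding ([_])
  open import Defs using (sumTo)
  open FinSums using (sumTo-cong; sumTo-const)

  <ᵇ-true : ∀ {a b} → a < b → (a <ᵇ b) ≡ true
  <ᵇ-true {a} {b} a<b with a <ᵇ b | <ᵇ-reflects-< a b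
  ... | true  | _        = refl
  ... | false | ofⁿ a≮b = contradiction a<b a≮b

  <ᵇ-false : ∀ {a b} → b ≤ a → (a <ᵇ b) ≡ false
  <ᵇ-false {a} {b} b≤a with a <ᵇ b | <ᵇ-reflects-< a b
  ... | true  | ofʸ a<b = contradiction b≤a (<⇒≱ a<b)
  ... | false | _        = refl

  ≤ᵇ-true : ∀ {a b} → a ≤ b → (a ≤ᵇ b) ≡ true
  ≤ᵇ-true {a} {b} a≤b with a ≤ᵇ b | ≤ᵇ-reflects-≤ a b
  ... | true  | _        = refl
  ... | false | ofⁿ a≰b = contradiction a≤b a≰b

  ≤ᵇ-false : ∀ {a b} → b < a → (a ≤ᵇ b) ≡ false
  ≤ᵇ-false {a} {b} b<a with a ≤ᵇ b | ≤ᵇ-reflects-≤ a b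
  ... | true  | ofʸ a≤b = contradiction b<a (≤⇒≯ a≤b)
  ... | false | _        = refl

  ≤ᵇ-sound : ∀ {a b} → (a ≤ᵇ b) ≡ true → a ≤ b
  ≤ᵇ-sound {a} {b} eq with a ≤ᵇ b | ≤ᵇ-reflects-≤ a b | eq
  ... | true | ofʸ a≤b | _ = a≤b

  [_<_] : ℕ → ℕ → ℕ
  [ a < b ] = if a <ᵇ b then 1 else 0

  [<]≤1 : ∀ a b → [ a < b ] ≤ 1
  [<]≤1 a b with a <ᵇ b
  ... | true  = ≤-refl
  ... | false = z≤n

  if-then-else-0 : ∀ a b x → (if a <ᵇ b then x else 0) ≡ x * [ a < b ]
  if-then-else-0 a b x with a <ᵇ b
  ... | true  = sym (*-identityʳ x)
  ... | false = sym (*-zeroʳ x)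

  sumTo-[<] : ∀ a n → sumTo (suc n) (λ j → [ a < j ]) ≡ n ∸ a
  sumTo-[<] a zero rewrite <ᵇ-false {a} {0} z≤n = sym (0∸n≡0 a)
  sumTo-[<] a (suc n) with a ≤? n
  ... | yes a≤n rewrite sumTo-[<] a n | <ᵇ-true {a} {suc n} (s≤s a≤n) =
    trans (+-comm (n ∸ a) 1) (sym (+-∸-assoc 1 a≤n))
  ... | no a≰n rewrite sumTo-[<] a n | <ᵇ-false {a} {suc n} (≰⇒> a≰n) =
    trans (+-identityʳ _) (trans (m≤n⇒m∸n≡0 (<⇒≤ (≰⇒> a≰n))) (sym (m≤n⇒m∸n≡0 (≰⇒> a≰n))))

  sumTo-weighted-[<] : ∀ a k → 2 * sumTo (suc (a + k)) (λ j → (j + 1) * [ a < j ]) + k * k ≡ k * (2 * (a + k) + 3)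
  sumTo-weighted-[<] a zero rewrite +-identityʳ a =
    cong (λ z → 2 * z + 0) (trans (sumTo-cong (suc a) vanish) (trans (sumTo-const (suc a) 0) (*-zeroʳ (suc a))))
    where
    vanish : ∀ j → j < suc a → (j + 1) * [ a < j ] ≡ 0
    vanish j j<1+a rewrite <ᵇ-false {a} {j} (s≤s⁻¹ j<1+a) = *-zeroʳ (j + 1)
  sumTo-weighted-[<] a (suc k) rewrite +-suc a k | <ᵇ-true {a} {suc (a + k)} (s≤s (m≤m+n a k)) = begin
      2 * (W + (suc (a + k) + 1) * 1) + suc k * suc k ≡⟨ split W a k ⟩
      (2 * W + k * k) + (2 * a + 4 * k + 5)         ≡⟨ cong (_+ (2 * a + 4 * k + 5)) (sumTo-weighted-[<] a k) ⟩
      k * (2 * (a + k) + 3) + (2 * a + 4 * k + 5)   ≡⟨ collect a k ⟩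
      suc k * (2 * suc (a + k) + 3)                 ∎
    where
    open ≡-Reasoning
    W = sumTo (suc (a + k)) (λ j → (j + 1) * [ a < j ])
    split : ∀ W a k → 2 * (W + (suc (a + k) + 1) * 1) + suc k * suc k ≡ (2 * W + k * k) + (2 * a + 4 * k + 5)
    split = solve-∀
    collect : ∀ a k → k * (2 * (a + k) + 3) + (2 * a + 4 * k + 5) ≡ suc k * (2 * suc (a + k) + 3)
    collect = solve-∀

module IntegerSums where
  open import Data.Nat as ℕ using (ℕ; zero; suc)
  open import Data.Integer using (ℤ; +_; _+_; _-_; -_; _≤_; 0ℤ)
  open import Data.Integer.Properties
  open import Algebra.Properties.CommutativeSemigroup +-commutativeSemigroup using (interchange)
  open import Data.Fin as Fin using (Fin)
  open import Function using (_∘_)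
  open import Relation.Binary.PropositionalEquality
  open import Defs using (sumF)

  sumZ : ∀ {k} → (Fin k → ℤ) → ℤ
  sumZ {zero}  f = 0ℤ
  sumZ {suc k} f = f Fin.zero + sumZ (f ∘ Fin.suc)

  +-sumF : ∀ {k} (f : Fin k → ℕ) → + sumF f ≡ sumZ (+_ ∘ f)
  +-sumF {zero}  f = refl
  +-sumF {suc k} f = cong (λ z → + f Fin.zero + z) (+-sumF (f ∘ Fin.suc))

  sumZ-cong : ∀ {k} {f g : Fin k → ℤ} → (∀ i → f i ≡ g i) → sumZ f ≡ sumZ g
  sumZ-cong {zero}  f≡g = refl
  sumZ-cong {suc k} f≡g = cong₂ _+_ (f≡g Fin.zero) (sumZ-cong (f≡g ∘ Fin.suc))

  sumZ-+ : ∀ {k} (f g : Fin k → ℤ) → sumZ (λ i → f i + g i) ≡ sumZ f + sumZ g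
  sumZ-+ {zero}  f g = refl
  sumZ-+ {suc k} f g rewrite sumZ-+ (f ∘ Fin.suc) (g ∘ Fin.suc) = interchange (f Fin.zero) (g Fin.zero) _ _

  sumZ-neg : ∀ {k} (f : Fin k → ℤ) → sumZ (λ i → - f i) ≡ - sumZ f
  sumZ-neg {zero}  f = refl
  sumZ-neg {suc k} f rewrite sumZ-neg (f ∘ Fin.suc) = sym (neg-distrib-+ (f Fin.zero) _)

  sumZ-difference : ∀ {k} (f g : Fin k → ℤ) → sumZ (λ i → f i - g i) ≡ sumZ f - sumZ g
  sumZ-difference f g = trans (sumZ-+ f (λ i → - g i)) (cong (λ z → sumZ f + z) (sumZ-neg g))

  sumZ-mono : ∀ {k} {f g : Fin k → ℤ} → (∀ i → f i ≤ g i) → sumZ f ≤ sumZ g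
  sumZ-mono {zero}  f≤g = ≤-refl
  sumZ-mono {suc k} f≤g = +-mono-≤ (f≤g Fin.zero) (sumZ-mono (f≤g ∘ Fin.suc))

  i≤i+nonNeg : ∀ {i j} → 0ℤ ≤ j → i ≤ i + j
  i≤i+nonNeg {i} 0≤j = subst (_≤ i + _) (+-identityʳ i) (+-monoʳ-≤ i 0≤j)

  sumZ-nonNeg : ∀ {k} {f : Fin k → ℤ} → (∀ i → 0ℤ ≤ f i) → 0ℤ ≤ sumZ f
  sumZ-nonNeg {zero}  0≤f = ≤-refl
  sumZ-nonNeg {suc k} 0≤f = +-mono-≤ (0≤f Fin.zero) (sumZ-nonNeg (0≤f ∘ Fin.suc))

  sumZ-nonNeg-≤0 : ∀ {k} {f : Fin k → ℤ} → (∀ i → 0ℤ ≤ f i) → sumZ f ≤ 0ℤ → ∀ i → f i ≡ 0ℤ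
  sumZ-nonNeg-≤0 {suc k} 0≤f Σf≤0 Fin.zero =
    ≤-antisym (≤-trans (i≤i+nonNeg (sumZ-nonNeg (0≤f ∘ Fin.suc))) Σf≤0) (0≤f Fin.zero)
  sumZ-nonNeg-≤0 {suc k} {f} 0≤f Σf≤0 (Fin.suc i) =
    sumZ-nonNeg-≤0 (0≤f ∘ Fin.suc)
      (≤-trans (subst (_≤ f Fin.zero + sumZ (f ∘ Fin.suc)) (+-identityˡ _)
                      (+-monoˡ-≤ (sumZ (f ∘ Fin.suc)) (0≤f Fin.zero))) Σf≤0) i

module IntegerBounds where
  open import Data.Nat as ℕ using (ℕ; zero; suc)
  import Data.Nat.Properties as ℕ
  open import Data.Integer using (ℤ; +_; -[1+_]; _+_; _*_; _-_; -_; _≤_; 0ℤ; 1ℤ; +≤+; -≤+; _≟_; NonZero)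
  open import Data.Integer.Properties
  open import Data.Integer.Tactic.RingSolver using (solve-∀)
  open import Data.Bool using (Bool; if_then_else_)
  open import Data.Fin using (Fin)
  open import Data.Product using (∃; _,_)
  open import Data.Sum using (_⊎_; inj₁; inj₂)
  open import Relation.Nullary using (yes; no; contradiction)
  open import Relation.Nullary.Decidable using (⌊_⌋)
  open import Relation.Binary.PropositionalEquality
  open import Defs using (sumF; sumSel)
  open IntegerSums

  private
    solve-for : ∀ {a b c : ℤ} → a + b ≡ c → a ≡ c - b
    solve-for {a} {b} refl = a≡a+b-b a b
      where
      a≡a+b-b : ∀ a b → a ≡ (a + b) - b
      a≡a+b-b = solve-∀

    halve : ∀ {a b} → + 2 * a ≤ + 2 * b → a ≤ b
    halve {a} {b} = *-cancelˡ-≤-pos a b (+ 2)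

    ≤-cast : ∀ {a b} {A B : ℤ} → a ℕ.≤ b → + a ≡ A → + b ≡ B → A ≤ B
    ≤-cast a≤b refl refl = +≤+ a≤b

    +2w+tt : ∀ w t → + (2 ℕ.* w ℕ.+ t ℕ.* t) ≡ + 2 * + w + + t * + t
    +2w+tt w t = trans (pos-+ (2 ℕ.* w) (t ℕ.* t)) (cong₂ _+_ (pos-* 2 w) (pos-* t t))

    +t[2k+1] : ∀ t k → + (t ℕ.* (2 ℕ.* k ℕ.+ 1)) ≡ + t * (+ 2 * + k + 1ℤ)
    +t[2k+1] t k = trans (pos-* t _) (cong (λ z → + t * z) (trans (pos-+ (2 ℕ.* k) 1) (cong (λ z → z + 1ℤ) (pos-* 2 k))))

  -- Twice the claim is the sum of the two packing hypotheses, once s = 2q + 1 − t and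
  -- 2h = q(2n + 3) − q² are substituted.
  threshold-bound : ∀ (w₁ w₂ t s q n h : ℤ) →
    + 2 * w₁ + t * t ≤ t * (+ 2 * (1ℤ + n) + 1ℤ) →
    + 2 * w₂ + s * s ≤ s * (+ 2 * (+ 2 + n) + 1ℤ) →
    t + s ≡ q + (q + 1ℤ) →
    + 2 * h + q * q ≡ q * (+ 2 * n + + 3) →
    w₁ + w₂ + (t - q) * (t - q) ≤ + 2 * h + n + + 2
  threshold-bound w₁ w₂ t s q n h w₁-bound w₂-bound t+s≡ 2h+q²≡
    with solve-for {s} (trans (+-comm s t) t+s≡)
  ... | refl = halve (begin
      + 2 * (w₁ + w₂ + (t - q) * (t - q))
        ≡⟨ split w₁ w₂ t q ⟩
      (+ 2 * w₁ + t * t) + (+ 2 * w₂ + s′ * s′) + R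
        ≤⟨ +-monoˡ-≤ R (+-mono-≤ w₁-bound w₂-bound) ⟩
      t * (+ 2 * (1ℤ + n) + 1ℤ) + s′ * (+ 2 * (+ 2 + n) + 1ℤ) + R
        ≡⟨ collect t q n ⟩
      + 2 * ((q * (+ 2 * n + + 3) - q * q) + n + + 2)
        ≡⟨ cong (λ z → + 2 * (z + n + + 2)) (sym (solve-for {+ 2 * h} {q * q} 2h+q²≡)) ⟩
      + 2 * (+ 2 * h + n + + 2) ∎)
    where
    open ≤-Reasoning
    s′ = q + (q + 1ℤ) - t
    R = + 2 * ((t - q) * (t - q)) - t * t - s′ * s′
    split : ∀ w₁ w₂ t q → + 2 * (w₁ + w₂ + (t - q) * (t - q))
      ≡ (+ 2 * w₁ + t * t) + (+ 2 * w₂ + (q + (q + 1ℤ) - t) * (q + (q + 1ℤ) - t))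
        + (+ 2 * ((t - q) * (t - q)) - t * t - (q + (q + 1ℤ) - t) * (q + (q + 1ℤ) - t))
    split = solve-∀
    collect : ∀ t q n → t * (+ 2 * (1ℤ + n) + 1ℤ) + (q + (q + 1ℤ) - t) * (+ 2 * (+ 2 + n) + 1ℤ)
        + (+ 2 * ((t - q) * (t - q)) - t * t - (q + (q + 1ℤ) - t) * (q + (q + 1ℤ) - t))
      ≡ + 2 * ((q * (+ 2 * n + + 3) - q * q) + n + + 2)
    collect = solve-∀

  threshold-bound-ℕ : ∀ (w₁ w₂ t s q n h : ℕ) →
    2 ℕ.* w₁ ℕ.+ t ℕ.* t ℕ.≤ t ℕ.* (2 ℕ.* suc n ℕ.+ 1) →
    2 ℕ.* w₂ ℕ.+ s ℕ.* s ℕ.≤ s ℕ.* (2 ℕ.* suc (suc n) ℕ.+ 1) →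
    t ℕ.+ s ≡ q ℕ.+ (q ℕ.+ 1) →
    2 ℕ.* h ℕ.+ q ℕ.* q ≡ q ℕ.* (2 ℕ.* n ℕ.+ 3) →
    + (w₁ ℕ.+ w₂) + (+ t - + q) * (+ t - + q) ≤ + (2 ℕ.* h ℕ.+ (n ℕ.+ 2))
  threshold-bound-ℕ w₁ w₂ t s q n h w₁-bound w₂-bound t+s≡ 2h+q²≡ =
    subst (λ z → z + (+ t - + q) * (+ t - + q) ≤ + (2 ℕ.* h ℕ.+ (n ℕ.+ 2))) (sym (pos-+ w₁ w₂))
      (subst (λ z → + w₁ + + w₂ + (+ t - + q) * (+ t - + q) ≤ z) rhs
        (threshold-bound (+ w₁) (+ w₂) (+ t) (+ s) (+ q) (+ n) (+ h)
          (≤-cast w₁-bound (+2w+tt w₁ t) (+t[2k+1] t (suc n)))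
          (≤-cast w₂-bound (+2w+tt w₂ s) (+t[2k+1] s (suc (suc n))))
          (cong +_ t+s≡)
          (trans (sym (+2w+tt h q)) (trans (cong +_ 2h+q²≡) (trans (pos-* q _)
            (cong (λ z → + q * z) (trans (pos-+ (2 ℕ.* n) 3) (cong (λ z → z + + 3) (pos-* 2 n)))))))))
    where
    rhs : + 2 * + h + + n + + 2 ≡ + (2 ℕ.* h ℕ.+ (n ℕ.+ 2))
    rhs = sym (trans (pos-+ (2 ℕ.* h) (n ℕ.+ 2))
      (trans (cong (λ z → z + + (n ℕ.+ 2)) (pos-* 2 h)) (sym (+-assoc (+ 2 * + h) (+ n) (+ 2)))))

  private
    move-left : ∀ a {b c} → a + b ≤ c → b ≤ c - a
    move-left a {b} {c} a+b≤c = subst (λ z → z ≤ c - a) (a+b-a≡b a b) (+-monoˡ-≤ (- a) a+b≤c)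
      where
      a+b-a≡b : ∀ a b → a + b - a ≡ b
      a+b-a≡b = solve-∀

    +-cancelˡ-≤′ : ∀ a {b c} → a + b ≤ a + c → b ≤ c
    +-cancelˡ-≤′ a {b} {c} a+b≤a+c = subst (λ z → b ≤ z) (a+c-a≡c a c) (move-left a a+b≤a+c)
      where
      a+c-a≡c : ∀ a c → a + c - a ≡ c
      a+c-a≡c = solve-∀

    0≤- : ∀ {a b} → a ≤ b → 0ℤ ≤ b - a
    0≤- {a} {b} a≤b = subst (λ z → z ≤ b - a) (+-inverseʳ a) (+-monoˡ-≤ (- a) a≤b)

    d≤d*d : ∀ d → d ≤ d * d
    d≤d*d (+ zero)  = ≤-refl
    d≤d*d (+ suc k) = subst (λ z → + suc k ≤ z) (pos-* (suc k) (suc k)) (+≤+ (ℕ.m≤m*n (suc k) (suc k)))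
    d≤d*d -[1+ k ]  = -≤+

    d[d-1]≡dd-d : ∀ d → d * (d - 1ℤ) ≡ d * d - d
    d[d-1]≡dd-d = solve-∀

    idempotent⇒0∨1 : ∀ d → d * d ≡ d → d ≡ 0ℤ ⊎ d ≡ 1ℤ
    idempotent⇒0∨1 d dd≡d
      with i*j≡0⇒i≡0∨j≡0 d {d - 1ℤ} (trans (d[d-1]≡dd-d d) (trans (cong (λ z → z - d) dd≡d) (+-inverseʳ d)))
    ... | inj₁ d≡0   = inj₁ d≡0
    ... | inj₂ d-1≡0 = inj₂ (i-j≡0⇒i≡j d 1ℤ d-1≡0)

  0≤d*d : ∀ d → 0ℤ ≤ d * d
  0≤d*d (+ k)     = subst (λ z → 0ℤ ≤ z) (pos-* k k) (+≤+ ℕ.z≤n)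
  0≤d*d -[1+ k ]  = +≤+ ℕ.z≤n

  0≤weighted-squares : ∀ {k} (x : Fin k → ℕ) (d : Fin k → ℤ) → 0ℤ ≤ sumZ (λ i → + x i * (d i * d i))
  0≤weighted-squares x d = sumZ-nonNeg (λ i → subst (λ z → z ≤ + x i * (d i * d i)) (*-zeroʳ (+ x i))
                                                     (*-monoˡ-≤-nonNeg (+ x i) (0≤d*d (d i))))

  +sumF-weighted : ∀ {k} (x u : Fin k → ℕ) → + sumF (λ i → x i ℕ.* u i) ≡ sumZ (λ i → + x i * + u i)
  +sumF-weighted {k} x u = trans (+-sumF {k} _) (sumZ-cong (λ i → pos-* (x i) (u i)))

  sumZ-weighted-difference : ∀ {k} (x a b : Fin k → ℕ) →
    sumZ (λ i → + x i * (+ a i - + b i)) ≡ + sumF (λ i → x i ℕ.* a i) - + sumF (λ i → x i ℕ.* b i)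
  sumZ-weighted-difference {k} x a b = begin
    sumZ (λ i → + x i * (+ a i - + b i))                     ≡⟨ sumZ-cong (λ i → distrib-minus (+ x i) (+ a i) (+ b i)) ⟩
    sumZ (λ i → + x i * + a i - + x i * + b i)               ≡⟨ sumZ-difference {k} _ _ ⟩
    sumZ (λ i → + x i * + a i) - sumZ (λ i → + x i * + b i)  ≡⟨ sym (cong₂ _-_ (+sumF-weighted x a) (+sumF-weighted x b)) ⟩
    + sumF (λ i → x i ℕ.* a i) - + sumF (λ i → x i ℕ.* b i)  ∎
    where
    open ≡-Reasoning
    distrib-minus : ∀ x a b → x * (a - b) ≡ x * a - x * b
    distrib-minus = solve-∀

  sumZ-weighted-bound : ∀ {k} (x u w : Fin k → ℕ) (v : Fin k → ℤ) → (∀ i → + u i + v i ≤ + w i) →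
    + sumF (λ i → x i ℕ.* u i) + sumZ (λ i → + x i * v i) ≤ + sumF (λ i → x i ℕ.* w i)
  sumZ-weighted-bound {k} x u w v u+v≤w = begin
    + sumF (λ i → x i ℕ.* u i) + sumZ (λ i → + x i * v i)    ≡⟨ cong (λ z → z + sumZ (λ i → + x i * v i)) (+sumF-weighted x u) ⟩
    sumZ (λ i → + x i * + u i) + sumZ (λ i → + x i * v i)    ≡⟨ sym (sumZ-+ {k} _ _) ⟩
    sumZ (λ i → + x i * + u i + + x i * v i)                 ≡⟨ sumZ-cong (λ i → sym (*-distribˡ-+ (+ x i) (+ u i) (v i))) ⟩
    sumZ (λ i → + x i * (+ u i + v i))                       ≤⟨ sumZ-mono (λ i → *-monoˡ-≤-nonNeg (+ x i) (u+v≤w i)) ⟩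
    sumZ (λ i → + x i * + w i)                               ≡⟨ sym (+sumF-weighted x w) ⟩
    + sumF (λ i → x i ℕ.* w i)                               ∎
    where open ≤-Reasoning

  combine-bounds : ∀ z {w g a b} → + w + z ≤ + g → g ℕ.+ a ℕ.≤ b ℕ.+ w → z + + a ≤ + b
  combine-bounds z {w} {g} {a} {b} w+z≤g g+a≤b+w = +-cancelˡ-≤′ (+ w) (begin
    + w + (z + + a)  ≡⟨ sym (+-assoc (+ w) z (+ a)) ⟩
    + w + z + + a    ≤⟨ +-monoˡ-≤ (+ a) w+z≤g ⟩
    + (g ℕ.+ a)      ≤⟨ +≤+ g+a≤b+w ⟩
    + (b ℕ.+ w)      ≡⟨ +-comm (+ b) (+ w) ⟩
    + w + + b        ∎)
    where open ≤-Reasoning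

  2a+2b≤c+2e⇒2b≤c+2[e-a] : ∀ {a b c e} → 2 ℕ.* a ℕ.+ 2 ℕ.* b ℕ.≤ c ℕ.+ 2 ℕ.* e → + 2 * + b ≤ + c + + 2 * (+ e - + a)
  2a+2b≤c+2e⇒2b≤c+2[e-a] {a} {b} {c} {e} le = begin
    + 2 * + b                                   ≡⟨ shift (+ a) (+ b) ⟩
    + 2 * + a + + 2 * + b - + 2 * + a           ≤⟨ +-monoˡ-≤ (- (+ 2 * + a)) (≤-cast le (+2a+2b a b) (+c+2e c e)) ⟩
    + c + + 2 * + e - + 2 * + a                 ≡⟨ regroup (+ c) (+ e) (+ a) ⟩
    + c + + 2 * (+ e - + a)                     ∎
    where
    open ≤-Reasoning
    shift : ∀ a b → + 2 * b ≡ + 2 * a + + 2 * b - + 2 * a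
    shift = solve-∀
    regroup : ∀ c e a → c + + 2 * e - + 2 * a ≡ c + + 2 * (e - a)
    regroup = solve-∀
    +2a+2b : ∀ a b → + (2 ℕ.* a ℕ.+ 2 ℕ.* b) ≡ + 2 * + a + + 2 * + b
    +2a+2b a b = trans (pos-+ (2 ℕ.* a) (2 ℕ.* b)) (cong₂ _+_ (pos-* 2 a) (pos-* 2 b))
    +c+2e : ∀ c e → + (c ℕ.+ 2 ℕ.* e) ≡ + c + + 2 * + e
    +c+2e c e = trans (pos-+ c (2 ℕ.* e)) (cong (λ z → + c + z) (pos-* 2 e))

  -- With E = Σ xᵢdᵢ ≤ Z = Σ xᵢdᵢ², the two hypotheses force Z = E = B, so every dᵢ² = dᵢ.
  subfamily-with-sum : ∀ {k} (x : Fin k → ℕ) (d : Fin k → ℤ) (pen B : ℕ) → (∀ i → 0 ℕ.< x i) →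
    sumZ (λ i → + x i * (d i * d i)) + + pen ≤ + B →
    + 2 * + B ≤ + pen + + 2 * sumZ (λ i → + x i * d i) →
    ∃ λ (S : Fin k → Bool) → sumSel x S ≡ B
  subfamily-with-sum x d pen B x>0 Z+pen≤B 2B≤pen+2E = (λ i → ⌊ d i ≟ 1ℤ ⌋) , selection-sum
    where
    Z = sumZ (λ i → + x i * (d i * d i))
    E = sumZ (λ i → + x i * d i)

    xd≤xdd : ∀ i → + x i * d i ≤ + x i * (d i * d i)
    xd≤xdd i = *-monoˡ-≤-nonNeg (+ x i) (d≤d*d (d i))

    E≤Z : E ≤ Z
    E≤Z = sumZ-mono xd≤xdd

    Z≤B : Z ≤ + B
    Z≤B = ≤-trans (i≤i+nonNeg (+≤+ ℕ.z≤n)) Z+pen≤B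

    B≤E : + B ≤ E
    B≤E = +-cancelˡ-≤′ (+ B) (begin
      + B + + B           ≡⟨ sym (double (+ B)) ⟩
      + 2 * + B           ≤⟨ 2B≤pen+2E ⟩
      + pen + + 2 * E     ≤⟨ +-monoˡ-≤ (+ 2 * E) (move-left Z Z+pen≤B) ⟩
      + B - Z + + 2 * E   ≤⟨ +-monoˡ-≤ (+ 2 * E) (+-monoʳ-≤ (+ B) (neg-mono-≤ E≤Z)) ⟩
      + B - E + + 2 * E   ≡⟨ simplify (+ B) E ⟩
      + B + E             ∎)
      where
      open ≤-Reasoning
      double : ∀ b → + 2 * b ≡ b + b
      double = solve-∀
      simplify : ∀ b e → b - e + + 2 * e ≡ b + e
      simplify = solve-∀

    d-idempotent : ∀ i → d i * d i ≡ d i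
    d-idempotent i = *-cancelˡ-≡ (+ x i) _ _ {{x≢0}} (i-j≡0⇒i≡j _ _ (terms-vanish i))
      where
      x≢0 : NonZero (+ x i)
      x≢0 with x i | x>0 i
      ... | suc _ | _ = _
      Z-E≤0 : Z - E ≤ 0ℤ
      Z-E≤0 = subst (λ z → Z - E ≤ z) (+-inverseʳ E)
                (+-monoˡ-≤ (- E) (≤-trans Z≤B B≤E))
      terms-vanish : ∀ i → + x i * (d i * d i) - + x i * d i ≡ 0ℤ
      terms-vanish = sumZ-nonNeg-≤0 (λ i → 0≤- (xd≤xdd i))
        (subst (λ z → z ≤ 0ℤ) (sym (sumZ-difference (λ i → + x i * (d i * d i)) (λ i → + x i * d i))) Z-E≤0)

    selected : ∀ i → + (if ⌊ d i ≟ 1ℤ ⌋ then x i else 0) ≡ + x i * d i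
    selected i with d i ≟ 1ℤ | idempotent⇒0∨1 (d i) (d-idempotent i)
    ... | yes d≡1 | _        = trans (sym (*-identityʳ (+ x i))) (cong (λ z → + x i * z) (sym d≡1))
    ... | no _    | inj₁ d≡0 = trans (sym (*-zeroʳ (+ x i))) (cong (λ z → + x i * z) (sym d≡0))
    ... | no d≢1  | inj₂ d≡1 = contradiction d≡1 d≢1

    selection-sum : sumSel x (λ i → ⌊ d i ≟ 1ℤ ⌋) ≡ B
    selection-sum = +-injective (trans (+-sumF (λ i → if ⌊ d i ≟ 1ℤ ⌋ then x i else 0))
      (trans (sumZ-cong selected) (≤-antisym (≤-trans E≤Z Z≤B) B≤E)))

open import Defs
open import Data.Nat using (ℕ; _<_; _*_; _+_)
open import Data.Fin using (Fin)
open import Data.Bool using (Bool)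
open import Data.List using (List; map)
open import Data.List.Relation.Binary.Permutation.Propositional using (_↭_)
open import Data.List.Base using (allFin)
open import Data.Product using (∃)
open import Relation.Binary.PropositionalEquality using (_≡_)

module Reduction (n : ℕ) (x : Fin n → ℕ) (B M : ℕ) (Σx≡2B : sumF x ≡ 2 * B) (5B<M : 5 * B < M) where
  open import Data.Nat using (suc; _+_; _*_; _∸_; _≤_; _<_; z≤n; s≤s; s≤s⁻¹; _≤ᵇ_; _<ᵇ_)
  open import Data.Nat.Properties
  open import Data.Nat.Tactic.RingSolver using (solve-∀)
  open import Data.Bool using (Bool; true; false; if_then_else_)
  open import Data.Fin using (toℕ)
  open import Data.Fin.Properties using (toℕ<n)
  open import Data.Sum using (_⊎_; inj₁; inj₂)
  open import Function using (_∘_)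
  open import Relation.Nullary using (contradiction)
  open import Relation.Binary.PropositionalEquality hiding ([_])
  open import Defs using (sumTo; module Instance)
  open Instance n x B M
  open FinSums
  open Iverson

  -- J_t and J_{n+1+t} (t ≤ n) have level t, the long job J_{2n+2} has level n; the
  -- processing time of a job is pre of its level, plus a surplus M − 4B for the long job.
  level : ℕ → ℕ
  level t = if t ≤ᵇ n then t else if t ≤ᵇ 2 * n + 1 then t ∸ (n + 1) else n

  base : ℕ → ℕ
  base t = pre (level t)

  surplus : ℕ → ℕ
  surplus t = if t ≤ᵇ n then 0 else if t ≤ᵇ 2 * n + 1 then 0 else M ∸ 4 * B

  4B≤M : 4 * B ≤ M
  4B≤M = ≤-trans (*-monoˡ-≤ B (n≤1+n 4)) (<⇒≤ 5B<M)

  B<M∸4B : B < M ∸ 4 * B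
  B<M∸4B = m+n≤o⇒m≤o∸n (suc B) (≤-trans (≤-reflexive (1+5B≡ B)) 5B<M)
    where
    1+5B≡ : ∀ B → suc B + 4 * B ≡ suc (5 * B)
    1+5B≡ = solve-∀

  pre≡Σx[<] : ∀ k → pre k ≡ sumF (λ i → x i * [ toℕ i < k ])
  pre≡Σx[<] k = sumF-cong (λ i → if-then-else-0 (toℕ i) k (x i))

  pre≤2B : ∀ k → pre k ≤ 2 * B
  pre≤2B k = ≤-trans (sumF-mono (λ i → if≤ (toℕ i <ᵇ k) (x i))) (≤-reflexive Σx≡2B)
    where
    if≤ : ∀ b y → (if b then y else 0) ≤ y
    if≤ true  y = ≤-refl
    if≤ false y = z≤n

  pre-0 : pre 0 ≡ 0
  pre-0 = sumF-* 0 x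

  pre-n : pre n ≡ 2 * B
  pre-n = trans (sumF-cong (λ i → cong (λ b → if b then x i else 0) (<ᵇ-true (toℕ<n i)))) Σx≡2B

  2B≤M : 2 * B ≤ M
  2B≤M = ≤-trans (*-monoˡ-≤ B {2} {4} (s≤s (s≤s z≤n))) 4B≤M

  2pre≤M : ∀ k → 2 * pre k ≤ M
  2pre≤M k = ≤-trans (*-monoʳ-≤ 2 (pre≤2B k)) (≤-trans (≤-reflexive (sym (*-assoc 2 2 B))) 4B≤M)

  M∸2B≡2B+surplus : M ∸ 2 * B ≡ 2 * B + (M ∸ 4 * B)
  M∸2B≡2B+surplus = begin
    M ∸ 2 * B                                ≡⟨ cong (_∸ 2 * B) (sym (m+[n∸m]≡n 4B≤M)) ⟩
    (4 * B + (M ∸ 4 * B)) ∸ 2 * B            ≡⟨ cong (_∸ 2 * B) (split B (M ∸ 4 * B)) ⟩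
    (2 * B + (2 * B + (M ∸ 4 * B))) ∸ 2 * B  ≡⟨ m+n∸m≡n (2 * B) _ ⟩
    2 * B + (M ∸ 4 * B)                      ∎
    where
    open ≡-Reasoning
    split : ∀ B r → 4 * B + r ≡ 2 * B + (2 * B + r)
    split = solve-∀

  2n+1<2n+2 : 2 * n + 1 < 2 * n + 2
  2n+1<2n+2 = ≤-reflexive (sym (+-suc (2 * n) 1))

  n≤2n+1 : n ≤ 2 * n + 1
  n≤2n+1 = ≤-trans (m≤m+n n (n + 0)) (m≤m+n (2 * n) 1)

  surplus≡0⊎M∸4B : ∀ t → surplus t ≡ 0 ⊎ surplus t ≡ M ∸ 4 * B
  surplus≡0⊎M∸4B t with t ≤ᵇ n | t ≤ᵇ 2 * n + 1
  ... | true  | _     = inj₁ refl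
  ... | false | true  = inj₁ refl
  ... | false | false = inj₂ refl

  pj≡base+surplus : ∀ t → pj t ≡ base t + surplus t
  pj≡base+surplus t with t ≤ᵇ n | t ≤ᵇ 2 * n + 1
  ... | true  | _     = sym (+-identityʳ _)
  ... | false | true  = sym (+-identityʳ _)
  ... | false | false rewrite pre-n = M∸2B≡2B+surplus

  δj+2base+surplus≡M : ∀ t → δj t + 2 * base t + surplus t ≡ M
  δj+2base+surplus≡M t with t ≤ᵇ n in t≤n | t ≤ᵇ 2 * n + 1 in t≤2n+1
  ... | true  | true  = trans (+-identityʳ _) (m∸n+n≡m (2pre≤M t))
  ... | true  | false = contradiction (trans (sym (≤ᵇ-true (≤-trans (≤ᵇ-sound {t} t≤n) n≤2n+1))) t≤2n+1) (λ ())
  ... | false | true  = trans (+-identityʳ _) (m∸n+n≡m (2pre≤M (t ∸ (n + 1))))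
  ... | false | false rewrite pre-n = trans (cong (_+ (M ∸ 4 * B)) (sym (*-assoc 2 2 B))) (m+[n∸m]≡n 4B≤M)

  pj+δj+base≡M : ∀ t → pj t + δj t + base t ≡ M
  pj+δj+base≡M t = begin
    pj t + δj t + base t                  ≡⟨ cong (λ z → z + δj t + base t) (pj≡base+surplus t) ⟩
    base t + surplus t + δj t + base t    ≡⟨ regroup (base t) (surplus t) (δj t) ⟩
    δj t + 2 * base t + surplus t         ≡⟨ δj+2base+surplus≡M t ⟩
    M                                     ∎
    where
    open ≡-Reasoning
    regroup : ∀ b s d → b + s + d + b ≡ d + 2 * b + s
    regroup = solve-∀

  m≡1+n+2+n : m ≡ suc n + suc (suc n)
  m≡1+n+2+n = 2n+3≡ n
    where
    2n+3≡ : ∀ n → 2 * n + 3 ≡ suc n + suc (suc n)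
    2n+3≡ = solve-∀

  sumTo-jobs : ∀ g → sumTo m g ≡ sumTo (suc n) g + (sumTo (suc n) (λ k → g (suc n + k)) + g (suc n + suc n))
  sumTo-jobs g = trans (cong (λ k → sumTo k g) m≡1+n+2+n) (sumTo-++ (suc n) (suc (suc n)) g)

  level-first : ∀ {t} → t ≤ n → level t ≡ t
  level-first t≤n rewrite ≤ᵇ-true t≤n = refl

  private
    1+n+n≡2n+1 : ∀ n → suc n + n ≡ 2 * n + 1
    1+n+n≡2n+1 = solve-∀

  second≤2n+1 : ∀ {k} → k ≤ n → suc n + k ≤ 2 * n + 1
  second≤2n+1 k≤n = ≤-trans (+-monoʳ-≤ (suc n) k≤n) (≤-reflexive (1+n+n≡2n+1 n))

  level-second : ∀ {k} → k ≤ n → level (suc n + k) ≡ k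
  level-second {k} k≤n rewrite ≤ᵇ-false {suc n + k} {n} (s≤s (m≤m+n n k)) | ≤ᵇ-true (second≤2n+1 k≤n) =
    trans (cong ((suc n + k) ∸_) (+-comm n 1)) (m+n∸m≡n (suc n) k)

  level-long : level (suc n + suc n) ≡ n
  level-long rewrite ≤ᵇ-false {suc n + suc n} {n} (s≤s (m≤m+n n (suc n)))
                   | ≤ᵇ-false {suc n + suc n} {2 * n + 1}
                       (≤-reflexive (trans (cong suc (sym (1+n+n≡2n+1 n))) (sym (+-suc (suc n) n)))) = refl

  sumTo-∘level : ∀ g → sumTo m (g ∘ level) ≡ sumTo (suc n) g + (sumTo (suc n) g + g n)
  sumTo-∘level g = trans (sumTo-jobs (g ∘ level))
    (cong₂ _+_ (sumTo-cong (suc n) (λ t t<1+n → cong g (level-first (s≤s⁻¹ t<1+n))))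
      (cong₂ _+_ (sumTo-cong (suc n) (λ k k<1+n → cong g (level-second (s≤s⁻¹ k<1+n)))) (cong g level-long)))

  count-above : ∀ i → sumTo m (λ t → [ toℕ i < level t ]) ≡ (n ∸ toℕ i) + ((n ∸ toℕ i) + 1)
  count-above i = trans (sumTo-∘level (λ l → [ toℕ i < l ]))
    (cong₂ (λ c b → c + (c + b)) (sumTo-[<] (toℕ i) n) (cong (λ b → if b then 1 else 0) (<ᵇ-true {toℕ i} {n} (toℕ<n i))))

  Σpre : ℕ
  Σpre = sumTo (suc n) pre

  sumTo-base : sumTo m base ≡ 2 * Σpre + 2 * B
  sumTo-base = trans (sumTo-∘level pre) (trans (cong (λ z → Σpre + (Σpre + z)) pre-n) (regroup Σpre B))
    where
    regroup : ∀ S B → S + (S + 2 * B) ≡ 2 * S + 2 * B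
    regroup = solve-∀

  Σpre≡Σx[n∸i] : Σpre ≡ sumF (λ i → x i * (n ∸ toℕ i))
  Σpre≡Σx[n∸i] = begin
    sumTo (suc n) pre                                        ≡⟨ sumTo-cong (suc n) (λ k _ → pre≡Σx[<] k) ⟩
    sumTo (suc n) (λ k → sumF (λ i → x i * [ toℕ i < k ]))   ≡⟨ linear-sumF (sumTo-linear (suc n)) x (λ i k → [ toℕ i < k ]) ⟩
    sumF (λ i → x i * sumTo (suc n) (λ k → [ toℕ i < k ]))   ≡⟨ sumF-cong (λ i → cong (x i *_) (sumTo-[<] (toℕ i) n)) ⟩
    sumF (λ i → x i * (n ∸ toℕ i))                           ∎
    where open ≡-Reasoning

  pj-first : ∀ {t} → t ≤ n → pj t ≡ pre t
  pj-first t≤n rewrite ≤ᵇ-true t≤n = refl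

  δj+2pre-first : ∀ {t} → t ≤ n → δj t + 2 * pre t ≡ M
  δj+2pre-first {t} t≤n rewrite ≤ᵇ-true t≤n | ≤ᵇ-true (≤-trans t≤n n≤2n+1) = m∸n+n≡m (2pre≤M t)

  pj+δj+pre-second : ∀ {k} → k ≤ n → pj (n + 1 + k) + δj (n + 1 + k) + pre k ≡ M
  pj+δj+pre-second {k} k≤n = trans (cong (λ l → pj t + δj t + pre l) (sym level≡k)) (pj+δj+base≡M t)
    where
    t = n + 1 + k
    level≡k : level t ≡ k
    level≡k = trans (cong (λ l → level (l + k)) (+-comm n 1)) (level-second k≤n)

  MLmax+2Σpre : MLmax + 2 * Σpre ≡ suc n * M
  MLmax+2Σpre = begin
    sumTo (suc n) δj + 2 * Σpre                  ≡⟨ cong (sumTo (suc n) δj +_) (sym (sumTo-* (suc n) 2 pre)) ⟩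
    sumTo (suc n) δj + sumTo (suc n) (λ t → 2 * pre t) ≡⟨ sym (sumTo-+ (suc n) δj _) ⟩
    sumTo (suc n) (λ t → δj t + 2 * pre t)       ≡⟨ sumTo-cong (suc n) (λ t t<1+n → δj+2pre-first (s≤s⁻¹ t<1+n)) ⟩
    sumTo (suc n) (λ _ → M)                      ≡⟨ sumTo-const (suc n) M ⟩
    suc n * M                                    ∎
    where open ≡-Reasoning

  2B≤MLmax : 2 * B ≤ MLmax
  2B≤MLmax = ≤-trans 2B≤M (≤-trans (≤-reflexive (sym δj0≡M))
                             (≤-trans (m≤m+n (δj 0) _) (≤-reflexive (sym (sumTo-suc n δj)))))
    where
    δj0≡M : δj 0 ≡ M
    δj0≡M rewrite pre-0 = refl

  ML₀+2Σpre+2B : ML₀ + (2 * Σpre + 2 * B) ≡ suc n * M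
  ML₀+2Σpre+2B = begin
    ML₀ + (2 * Σpre + 2 * B)      ≡⟨ cong (ML₀ +_) (+-comm (2 * Σpre) (2 * B)) ⟩
    ML₀ + (2 * B + 2 * Σpre)      ≡⟨ sym (+-assoc ML₀ (2 * B) _) ⟩
    ML₀ + 2 * B + 2 * Σpre        ≡⟨ cong (_+ 2 * Σpre) (m∸n+n≡m 2B≤MLmax) ⟩
    MLmax + 2 * Σpre              ≡⟨ MLmax+2Σpre ⟩
    suc n * M                     ∎
    where open ≡-Reasoning

  H : Fin n → ℕ
  H i = sumTo (suc n) (λ j → (j + 1) * [ toℕ i < j ])

  2H+q² : ∀ i → 2 * H i + (n ∸ toℕ i) * (n ∸ toℕ i) ≡ (n ∸ toℕ i) * (2 * n + 3)
  2H+q² i = subst (λ N → 2 * sumTo (suc N) (λ j → (j + 1) * [ toℕ i < j ]) + q * q ≡ q * (2 * N + 3))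
                  (m+[n∸m]≡n (<⇒≤ (toℕ<n i))) (sumTo-weighted-[<] (toℕ i) q)
    where q = n ∸ toℕ i

  ΣG : ℕ
  ΣG = sumF (λ i → x i * (2 * H i + (n + 2)))

  Q₀-identity : Q₀ + ΣG ≡ M * triangle (suc (suc n)) + (n + 2) * (2 * Σpre + 2 * B)
  Q₀-identity = begin
      Q₀ + ΣG
        ≡⟨ cong₂ _+_ Q₀≡ ΣG≡ ⟩
      (A₁ + (n + 2) * (Σpre + M) + A₃) + (2 * A₂ + (n + 2) * (2 * B))
        ≡⟨ regroup A₁ A₂ A₃ n Σpre M B ⟩
      (A₁ + A₂) + (A₃ + A₂) + (n + 2) * (Σpre + M) + (n + 2) * (2 * B)
        ≡⟨ cong₂ (λ a b → a + b + (n + 2) * (Σpre + M) + (n + 2) * (2 * B)) A₁+A₂ A₃+A₂ ⟩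
      (n + 2) * Σpre + M * triangle (suc n) + (n + 2) * (Σpre + M) + (n + 2) * (2 * B)
        ≡⟨ collect n Σpre M B (triangle (suc n)) ⟩
      M * triangle (suc (suc n)) + (n + 2) * (2 * Σpre + 2 * B) ∎
    where
    open ≡-Reasoning
    A₁ = sumTo (suc n) (λ j → (n ∸ j + 1) * pj j)
    A₂ = sumTo (suc n) (λ j → (j + 1) * pre j)
    A₃ = sumTo (suc n) (λ j → (j + 1) * (pj (n + 1 + j) + δj (n + 1 + j)))

    A₂≡ΣxH : A₂ ≡ sumF (λ i → x i * H i)
    A₂≡ΣxH = trans (sumTo-cong (suc n) (λ j _ → expand j))
                   (linear-sumF (sumTo-linear (suc n)) x (λ i j → (j + 1) * [ toℕ i < j ]))
      where
      expand : ∀ j → (j + 1) * pre j ≡ sumF (λ i → x i * ((j + 1) * [ toℕ i < j ]))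
      expand j = trans (cong ((j + 1) *_) (pre≡Σx[<] j))
        (trans (sym (sumF-* {n} (j + 1) _)) (sumF-cong (λ i → *-comm-assoc (j + 1) (x i) [ toℕ i < j ])))
        where
        *-comm-assoc : ∀ a b c → a * (b * c) ≡ b * (a * c)
        *-comm-assoc = solve-∀

    ΣG≡ : ΣG ≡ 2 * A₂ + (n + 2) * (2 * B)
    ΣG≡ = begin
      sumF (λ i → x i * (2 * H i + (n + 2)))          ≡⟨ sumF-cong (λ i → distrib (x i) (H i) n) ⟩
      sumF (λ i → 2 * (x i * H i) + (n + 2) * x i)    ≡⟨ sumF-+ {n} _ _ ⟩
      sumF (λ i → 2 * (x i * H i)) + sumF (λ i → (n + 2) * x i)
                                                      ≡⟨ cong₂ _+_ (sumF-* {n} 2 _) (sumF-* (n + 2) x) ⟩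
      2 * sumF (λ i → x i * H i) + (n + 2) * sumF x   ≡⟨ cong₂ (λ a b → 2 * a + (n + 2) * b) (sym A₂≡ΣxH) Σx≡2B ⟩
      2 * A₂ + (n + 2) * (2 * B)                      ∎
      where
      distrib : ∀ a h n → a * (2 * h + (n + 2)) ≡ 2 * (a * h) + (n + 2) * a
      distrib = solve-∀

    Q₀≡ : Q₀ ≡ A₁ + (n + 2) * (Σpre + M) + A₃
    Q₀≡ = cong (λ z → A₁ + (n + 2) * z + A₃)
      (trans (+-assoc (sumTo (suc n) pj) (2 * B) _)
        (cong₂ _+_ (sumTo-cong (suc n) (λ j j<1+n → pj-first (s≤s⁻¹ j<1+n))) 2B+long≡M))
      where
      2B+long≡M : 2 * B + pj (2 * n + 2) ≡ M
      2B+long≡M rewrite ≤ᵇ-false {2 * n + 2} {n} (≤-trans (s≤s n≤2n+1) 2n+1<2n+2) | ≤ᵇ-false 2n+1<2n+2 = m+[n∸m]≡n 2B≤M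

    A₁+A₂ : A₁ + A₂ ≡ (n + 2) * Σpre
    A₁+A₂ = begin
      A₁ + A₂                                              ≡⟨ sym (sumTo-+ (suc n) _ _) ⟩
      sumTo (suc n) (λ j → (n ∸ j + 1) * pj j + (j + 1) * pre j) ≡⟨ sumTo-cong (suc n) (λ j j<1+n → weights (s≤s⁻¹ j<1+n)) ⟩
      sumTo (suc n) (λ j → (n + 2) * pre j)                ≡⟨ sumTo-* (suc n) (n + 2) pre ⟩
      (n + 2) * Σpre                                       ∎
      where
      weights : ∀ {j} → j ≤ n → (n ∸ j + 1) * pj j + (j + 1) * pre j ≡ (n + 2) * pre j
      weights {j} j≤n rewrite pj-first j≤n = trans (sym (*-distribʳ-+ (pre j) (n ∸ j + 1) (j + 1)))
        (cong (_* pre j) (trans (regroup′ (n ∸ j) j) (cong (_+ 2) (m∸n+n≡m j≤n))))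
        where
        regroup′ : ∀ a b → a + 1 + (b + 1) ≡ a + b + 2
        regroup′ = solve-∀

    A₃+A₂ : A₃ + A₂ ≡ M * triangle (suc n)
    A₃+A₂ = begin
      A₃ + A₂                                   ≡⟨ sym (sumTo-+ (suc n) _ _) ⟩
      sumTo (suc n) (λ j → (j + 1) * (pj (n + 1 + j) + δj (n + 1 + j)) + (j + 1) * pre j)
                                                ≡⟨ sumTo-cong (suc n) (λ j j<1+n → weights (s≤s⁻¹ j<1+n)) ⟩
      sumTo (suc n) (λ j → M * (j + 1))         ≡⟨ sumTo-* (suc n) M (λ j → j + 1) ⟩
      M * sumTo (suc n) (λ j → j + 1)           ≡⟨ cong (M *_) (sumTo-triangle (suc n)) ⟩
      M * triangle (suc n)                      ∎
      where
      weights : ∀ {j} → j ≤ n → (j + 1) * (pj (n + 1 + j) + δj (n + 1 + j)) + (j + 1) * pre j ≡ M * (j + 1)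
      weights {j} j≤n = trans (sym (*-distribˡ-+ (j + 1) _ (pre j)))
                              (trans (cong ((j + 1) *_) (pj+δj+pre-second j≤n)) (*-comm (j + 1) M))

    regroup : ∀ A₁ A₂ A₃ n S M B → (A₁ + (n + 2) * (S + M) + A₃) + (2 * A₂ + (n + 2) * (2 * B))
      ≡ (A₁ + A₂) + (A₃ + A₂) + (n + 2) * (S + M) + (n + 2) * (2 * B)
    regroup = solve-∀
    collect : ∀ n S M B T → (n + 2) * S + M * T + (n + 2) * (S + M) + (n + 2) * (2 * B)
      ≡ M * (suc (suc n) + T) + (n + 2) * (2 * S + 2 * B)
    collect = solve-∀

module OrderAnalysis (n : ℕ) (x : Fin n → ℕ) (B M : ℕ) (Σx≡2B : sumF x ≡ 2 * B) (5B<M : 5 * B < M) where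
  open import Data.Nat using (suc; _+_; _*_; _∸_; _≤_; _<_)
  open import Data.Nat.Properties
  open import Data.Nat.ListAction using (sum)
  open import Data.Nat.ListAction.Properties using (sum-++; sum-↭)
  open import Data.Nat.Tactic.RingSolver using (solve-∀)
  open import Data.Bool using (Bool)
  open import Data.Fin using (toℕ)
  open import Data.List using (List; map; length; _++_; allFin; tabulate; take; drop)
  import Data.List.Properties as List
  open import Data.List.Relation.Binary.Permutation.Propositional using (_↭_)
  open import Data.List.Relation.Binary.Permutation.Propositional.Properties using (map⁺; ↭-length)
  open import Data.Integer as ℤ using (ℤ; +_)
  import Data.Integer.Properties as ℤ
  open import Data.Product using (∃)
  open import Data.Sum using (inj₁; inj₂)
  open import Function using (_∘_; id)
  open import Relation.Nullary using (contradiction)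
  open import Relation.Binary.PropositionalEquality hiding ([_])
  open import Defs using (sumTo; sumSel; module Instance)
  open Instance n x B M
  open Reduction n x B M Σx≡2B 5B<M
  open FinSums
  open ListSums
  open ForcedCost p δ ML₀
  open Iverson
  open IntegerSums
  open IntegerBounds

  jobBase : Fin m → ℕ
  jobBase = base ∘ toℕ

  jobSurplus : Fin m → ℕ
  jobSurplus = surplus ∘ toℕ

  above : Fin n → Fin m → ℕ
  above i j = [ toℕ i < level (toℕ j) ]

  linear-jobBase : ∀ {Λ} → Linear Λ → Λ jobBase ≡ sumF (λ i → x i * Λ (above i))
  linear-jobBase L = trans (Linear.ext L (λ j → pre≡Σx[<] (level (toℕ j)))) (linear-sumF L x above)

  module _ (f r : List (Fin m)) (f++r↭all : f ++ r ↭ allFin m) (|f|≡ : length f ≡ suc n) where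

    sum-f+sum-r : ∀ g → sum (map (g ∘ toℕ) f) + sum (map (g ∘ toℕ) r) ≡ sumTo m g
    sum-f+sum-r g = begin
      sum (map h f) + sum (map h r)  ≡⟨ sym (sum-++ (map h f) (map h r)) ⟩
      sum (map h f ++ map h r)       ≡⟨ cong sum (sym (List.map-++ h f r)) ⟩
      sum (map h (f ++ r))           ≡⟨ sum-↭ (map⁺ h f++r↭all) ⟩
      sum (map h (allFin m))         ≡⟨ cong sum (List.map-tabulate id h) ⟩
      sum (tabulate h)               ≡⟨ sum-tabulate h ⟩
      sumF h                         ≡⟨ sumF-toℕ m g ⟩
      sumTo m g                      ∎
      where
      open ≡-Reasoning
      h = g ∘ toℕ

    |r|≡ : length r ≡ suc (suc n)
    |r|≡ = +-cancelˡ-≡ (suc n) _ _ (begin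
      suc n + length r       ≡⟨ cong (_+ length r) (sym |f|≡) ⟩
      length f + length r    ≡⟨ sym (List.length-++ f) ⟩
      length (f ++ r)        ≡⟨ ↭-length f++r↭all ⟩
      length (allFin m)      ≡⟨ List.length-tabulate id ⟩
      m                      ≡⟨ m≡1+n+2+n ⟩
      suc n + suc (suc n)    ∎)
      where open ≡-Reasoning

    Ef Er Pf Δf Δf∸ML₀ surplusCost : ℕ
    Ef          = sum (map jobBase f)
    Er          = sum (map jobBase r)
    Pf          = sum (map p f)
    Δf          = sum (map δ f)
    Δf∸ML₀      = Δf ∸ ML₀
    surplusCost = prefixSums jobSurplus f

    Ef+Er≡ : Ef + Er ≡ 2 * Σpre + 2 * B
    Ef+Er≡ = trans (sum-f+sum-r base) sumTo-base

    Pf+Δf≡ML₀+Er : Pf + Δf ≡ ML₀ + Er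
    Pf+Δf≡ML₀+Er = +-cancelʳ-≡ Ef _ _ (begin
      Pf + Δf + Ef                              ≡⟨ cong (_+ Ef) (sym (Linear.additive (sum-map-linear f) p δ)) ⟩
      sum (map (λ j → p j + δ j) f) + Ef        ≡⟨ sum-map-complement M (pj+δj+base≡M ∘ toℕ) f ⟩
      M * length f                              ≡⟨ cong (M *_) |f|≡ ⟩
      M * suc n                                 ≡⟨ *-comm M (suc n) ⟩
      suc n * M                                 ≡⟨ sym ML₀+2Σpre+2B ⟩
      ML₀ + (2 * Σpre + 2 * B)                  ≡⟨ cong (λ z → ML₀ + z) (sym (trans (+-comm Er Ef) Ef+Er≡)) ⟩
      ML₀ + (Er + Ef)                           ≡⟨ sym (+-assoc ML₀ Er Ef) ⟩
      ML₀ + Er + Ef                             ∎)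
      where open ≡-Reasoning

    ΣW : ℕ
    ΣW = positionalSum jobBase f + prefixSums jobBase r

    forcedCost-lower-bound : M * triangle (suc (suc n)) + (n + 2) * (2 * Σpre + 2 * B) + (surplusCost + Δf∸ML₀)
                             ≤ forcedCost 0 0 (f ++ r) + ΣW
    forcedCost-lower-bound = begin
      M * triangle (suc (suc n)) + (n + 2) * (2 * Σpre + 2 * B) + (surplusCost + Δf∸ML₀)
        ≡⟨ cong₂ (λ a b → a + (n + 2) * b + (surplusCost + Δf∸ML₀)) (sym RD+RB) (sym Ef+Er≡) ⟩
      (RD + RB) + (n + 2) * (Ef + Er) + (surplusCost + Δf∸ML₀)
        ≡⟨ regroup RD RB n Ef Er surplusCost Δf∸ML₀ ⟩
      (suc (suc n) * Ef + surplusCost + Δf∸ML₀ + (n + 2) * Er + RD) + RB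
        ≡⟨ cong (λ z → (z + surplusCost + Δf∸ML₀ + (n + 2) * Er + RD) + RB) (sym PB+WB) ⟩
      (PB + WB + surplusCost + Δf∸ML₀ + (n + 2) * Er + RD) + RB
        ≡⟨ regroup′ PB WB surplusCost Δf∸ML₀ ((n + 2) * Er) RD RB ⟩
      ((PB + surplusCost) + Δf∸ML₀ + ((n + 2) * Er + RD)) + ΣW
        ≡⟨ cong (λ z → (z + Δf∸ML₀ + ((n + 2) * Er + RD)) + ΣW) (sym Pp≡PB+surplusCost) ⟩
      (prefixSums p f + Δf∸ML₀ + ((n + 2) * Er + RD)) + ΣW
        ≤⟨ +-monoˡ-≤ ΣW (+-mono-≤ (forcedCost-from-start f) rest-cost) ⟩
      (forcedCost 0 0 f + forcedCost Pf Δf r) + ΣW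
        ≡⟨ cong (_+ ΣW) (sym (forcedCost-++ 0 0 f r)) ⟩
      forcedCost 0 0 (f ++ r) + ΣW ∎
      where
      open ≤-Reasoning
      PB = prefixSums jobBase f
      WB = positionalSum jobBase f
      RB = prefixSums jobBase r
      RD = prefixSums (λ j → p j + δ j) r

      RD+RB : RD + RB ≡ M * triangle (suc (suc n))
      RD+RB = trans (prefixSums-complement M (pj+δj+base≡M ∘ toℕ) r) (cong (λ l → M * triangle l) |r|≡)

      PB+WB : PB + WB ≡ suc (suc n) * Ef
      PB+WB = trans (prefixSums+positionalSum jobBase f) (cong (λ l → suc l * Ef) |f|≡)

      Pp≡PB+surplusCost : prefixSums p f ≡ PB + surplusCost
      Pp≡PB+surplusCost = trans (Linear.ext (prefixSums-linear f) (pj≡base+surplus ∘ toℕ))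
                        (Linear.additive (prefixSums-linear f) jobBase jobSurplus)

      rest-cost : (n + 2) * Er + RD ≤ forcedCost Pf Δf r
      rest-cost = subst (λ l → l * Er + RD ≤ forcedCost Pf Δf r) (trans |r|≡ (+-comm 2 n))
                         (forcedCost-≥-excess Pf Δf Er r Pf+Δf≡ML₀+Er)

      regroup : ∀ RD RB n Ef Er c e → (RD + RB) + (n + 2) * (Ef + Er) + (c + e)
        ≡ (suc (suc n) * Ef + c + e + (n + 2) * Er + RD) + RB
      regroup = solve-∀
      regroup′ : ∀ PB WB c e E RD RB → (PB + WB + c + e + E + RD) + RB
        ≡ ((PB + c) + e + (E + RD)) + (WB + RB)
      regroup′ = solve-∀

    τ σ q W₁ W₂ : Fin n → ℕ
    τ i  = sum (map (above i) f)
    σ i  = sum (map (above i) r)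
    q i  = n ∸ toℕ i
    W₁ i = positionalSum (above i) f
    W₂ i = prefixSums (above i) r

    d : Fin n → ℤ
    d i = + τ i ℤ.- + q i

    threshold : ∀ i → + (W₁ i + W₂ i) ℤ.+ d i ℤ.* d i ℤ.≤ + (2 * H i + (n + 2))
    threshold i = threshold-bound-ℕ (W₁ i) (W₂ i) (τ i) (σ i) (q i) n (H i)
      (subst (λ l → 2 * W₁ i + τ i * τ i ≤ τ i * (2 * l + 1)) |f|≡ (positionalSum-packing (above i) above≤1 f))
      (subst (λ l → 2 * W₂ i + σ i * σ i ≤ σ i * (2 * l + 1)) |r|≡ (prefixSums-packing (above i) above≤1 r))
      (trans (sum-f+sum-r (λ t → [ toℕ i < level t ])) (count-above i))
      (2H+q² i)
      where
      above≤1 : ∀ j → above i j ≤ 1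
      above≤1 j = [<]≤1 (toℕ i) (level (toℕ j))

    Z : ℤ
    Z = sumZ (λ i → + x i ℤ.* (d i ℤ.* d i))

    ΣW+Z≤ΣG : + ΣW ℤ.+ Z ℤ.≤ + ΣG
    ΣW+Z≤ΣG = subst (λ c → + c ℤ.+ Z ℤ.≤ _) (sym ΣW≡) (sumZ-weighted-bound x _ _ _ threshold)
      where
      ΣW≡ : ΣW ≡ sumF (λ i → x i * (W₁ i + W₂ i))
      ΣW≡ = begin
        positionalSum jobBase f + prefixSums jobBase r
          ≡⟨ cong₂ _+_ (linear-jobBase (positionalSum-linear f)) (linear-jobBase (prefixSums-linear r)) ⟩
        sumF (λ i → x i * W₁ i) + sumF (λ i → x i * W₂ i)
          ≡⟨ sym (sumF-+ {n} _ _) ⟩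
        sumF (λ i → x i * W₁ i + x i * W₂ i)
          ≡⟨ sumF-cong (λ i → sym (*-distribˡ-+ (x i) (W₁ i) (W₂ i))) ⟩
        sumF (λ i → x i * (W₁ i + W₂ i)) ∎
        where open ≡-Reasoning

    E≡Ef-Σpre : sumZ (λ i → + x i ℤ.* d i) ≡ + Ef ℤ.- + Σpre
    E≡Ef-Σpre = trans (sumZ-weighted-difference x τ q)
      (cong₂ ℤ._-_ (cong +_ (sym (linear-jobBase (sum-map-linear f)))) (cong +_ (sym Σpre≡Σx[n∸i])))

    module _ (cost≤Q : forcedCost 0 0 (f ++ r) ≤ Q) where

      ΣG+surplusCost+Δf∸ML₀≤B+ΣW : ΣG + (surplusCost + Δf∸ML₀) ≤ B + ΣW
      ΣG+surplusCost+Δf∸ML₀≤B+ΣW = +-cancelˡ-≤ Q₀ _ _ (begin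
        Q₀ + (ΣG + (surplusCost + Δf∸ML₀))    ≡⟨ sym (+-assoc Q₀ ΣG _) ⟩
        Q₀ + ΣG + (surplusCost + Δf∸ML₀)      ≡⟨ cong (_+ (surplusCost + Δf∸ML₀)) Q₀-identity ⟩
        M * triangle (suc (suc n)) + (n + 2) * (2 * Σpre + 2 * B) + (surplusCost + Δf∸ML₀)
                                              ≤⟨ forcedCost-lower-bound ⟩
        forcedCost 0 0 (f ++ r) + ΣW          ≤⟨ +-monoˡ-≤ ΣW cost≤Q ⟩
        Q₀ + B + ΣW                           ≡⟨ +-assoc Q₀ B ΣW ⟩
        Q₀ + (B + ΣW)                         ∎)
        where open ≤-Reasoning

      Z+surplusCost+Δf∸ML₀≤B : Z ℤ.+ + (surplusCost + Δf∸ML₀) ℤ.≤ + B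
      Z+surplusCost+Δf∸ML₀≤B = combine-bounds Z ΣW+Z≤ΣG ΣG+surplusCost+Δf∸ML₀≤B+ΣW

      surplusCost≤B : surplusCost ≤ B
      surplusCost≤B = ℤ.drop‿+≤+ (ℤ.≤-trans (ℤ.+≤+ (m≤m+n surplusCost Δf∸ML₀))
        (ℤ.≤-trans (ℤ.+-monoˡ-≤ (+ (surplusCost + Δf∸ML₀)) (0≤weighted-squares x d)) Z+surplusCost+Δf∸ML₀≤B))

      -- The long job cannot be among the first n + 1: it alone would cost M − 4B > B.
      Σsurplus-f≡0 : sum (map jobSurplus f) ≡ 0
      Σsurplus-f≡0 with sum-map-gap jobSurplus (M ∸ 4 * B) (surplus≡0⊎M∸4B ∘ toℕ) f
      ... | inj₁ Σ≡0 = Σ≡0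
      ... | inj₂ K≤Σ =
        contradiction (≤-trans K≤Σ (≤-trans (sum-map≤prefixSums jobSurplus f) surplusCost≤B)) (<⇒≱ B<M∸4B)

      Δf+2Ef≡ : Δf + 2 * Ef ≡ suc n * M
      Δf+2Ef≡ = begin
        Δf + 2 * Ef                                            ≡⟨ cong (λ z → Δf + z) (sym (+-identityʳ (2 * Ef))) ⟩
        Δf + (2 * Ef + 0)                                      ≡⟨ cong (λ z → Δf + (2 * Ef + z)) (sym Σsurplus-f≡0) ⟩
        Δf + (2 * Ef + sum (map jobSurplus f))                 ≡⟨ cong (λ z → Δf + z) (sym 2Ef+Σsurplus) ⟩
        Δf + sum (map (λ j → 2 * jobBase j + jobSurplus j) f)  ≡⟨ sum-map-complement M δ+2base+surplus≡M f ⟩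
        M * length f                                           ≡⟨ cong (M *_) |f|≡ ⟩
        M * suc n                                              ≡⟨ *-comm M (suc n) ⟩
        suc n * M                                              ∎
        where
        open ≡-Reasoning
        2Ef+Σsurplus : sum (map (λ j → 2 * jobBase j + jobSurplus j) f) ≡ 2 * Ef + sum (map jobSurplus f)
        2Ef+Σsurplus = trans (Linear.additive (sum-map-linear f) _ jobSurplus)
                             (cong (_+ sum (map jobSurplus f)) (Linear.homogeneous (sum-map-linear f) 2 jobBase))
        δ+2base+surplus≡M : ∀ j → δ j + (2 * jobBase j + jobSurplus j) ≡ M
        δ+2base+surplus≡M j = trans (sym (+-assoc (δ j) _ _)) (δj+2base+surplus≡M (toℕ j))

      2Σpre+2B≤Δf∸ML₀+2Ef : 2 * Σpre + 2 * B ≤ Δf∸ML₀ + 2 * Ef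
      2Σpre+2B≤Δf∸ML₀+2Ef = +-cancelˡ-≤ ML₀ _ _ (begin
        ML₀ + (2 * Σpre + 2 * B)   ≡⟨ trans ML₀+2Σpre+2B (sym Δf+2Ef≡) ⟩
        Δf + 2 * Ef                ≤⟨ +-monoˡ-≤ (2 * Ef) (m≤n+m∸n Δf ML₀) ⟩
        ML₀ + Δf∸ML₀ + 2 * Ef      ≡⟨ +-assoc ML₀ Δf∸ML₀ (2 * Ef) ⟩
        ML₀ + (Δf∸ML₀ + 2 * Ef)    ∎)
        where open ≤-Reasoning

      subset-from-split : (∀ i → 0 < x i) → ∃ λ (S : Fin n → Bool) → sumSel x S ≡ B
      subset-from-split x>0 = subfamily-with-sum x d Δf∸ML₀ B x>0
        (ℤ.≤-trans (ℤ.+-monoʳ-≤ Z (ℤ.+≤+ (m≤n+m Δf∸ML₀ surplusCost))) Z+surplusCost+Δf∸ML₀≤B)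
        (subst (λ e → + 2 ℤ.* + B ℤ.≤ + Δf∸ML₀ ℤ.+ + 2 ℤ.* e) (sym E≡Ef-Σpre)
               (2a+2b≤c+2e⇒2b≤c+2[e-a] {Σpre} {B} {Δf∸ML₀} {Ef} 2Σpre+2B≤Δf∸ML₀+2Ef))

  subset-from-order : ∀ js → js ↭ allFin m → forcedCost 0 0 js ≤ Q → (∀ i → 0 < x i) →
                      ∃ λ (S : Fin n → Bool) → sumSel x S ≡ B
  subset-from-order js js↭all cost≤Q =
    subset-from-split (take (suc n) js) (drop (suc n) js)
      (subst (_↭ allFin m) (sym take++drop) js↭all) |take|≡ (subst (λ l → forcedCost 0 0 l ≤ Q) (sym take++drop) cost≤Q)
    where
    take++drop : take (suc n) js ++ drop (suc n) js ≡ js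
    take++drop = List.take++drop≡id (suc n) js
    |take|≡ : length (take (suc n) js) ≡ suc n
    |take|≡ = trans (List.length-take (suc n) js) (m≤n⇒m⊓n≡m (≤-trans (m≤m+n (suc n) (suc (suc n)))
      (≤-reflexive (sym (trans (↭-length js↭all) (trans (List.length-tabulate id) m≡1+n+2+n))))))

open import Data.Rational using (_≤_; 0ℚ)
import Data.Nat as ℕ
import Data.Nat.Properties as ℕ
import Data.Rational.Properties as ℚ

5B<M : ∀ n B M → (4 * n + 8) * B < M → 5 * B < M
5B<M n B M = ℕ.≤-<-trans (ℕ.*-monoˡ-≤ B (ℕ.≤-trans (ℕ.m≤n+m 5 3) (ℕ.m≤n+m 8 (4 * n))))

theorem10 : (n : ℕ) (x : Fin n → ℕ) (B M : ℕ)
    → (∀ i → 0 < x i)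
    → sumF x ≡ 2 * B
    → (4 * n + 8) * B < M
    → let open Instance n x B M
          open Scheduling p δ MLmax
      in (s : List Step)
    → map job s ↭ allFin m
    → FeasibleFrom 0ℚ (ℕ→ℚ ML₀) s
    → TotalFrom 0ℚ s ≤ ℕ→ℚ Q
    → ∃ λ (S : Fin n → Bool) → sumSel x S ≡ B
theorem10 n x B M x>0 Σx≡2B M-large s order feasible total≤Q =
  OrderAnalysis.subset-from-order n x B M Σx≡2B (5B<M n B M M-large) (map job s) order forcedCost≤Q x>0
  where
  open Instance n x B M
  open Scheduling p δ MLmax
  open ForcedCost p δ ML₀
  open CompletionTimes
  forcedCost≤Q : forcedCost 0 0 (map job s) ℕ.≤ Q
  forcedCost≤Q = ℕ→ℚ-cancel-≤ (ℚ.≤-trans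
    (TotalFrom-≥-forcedCost p δ MLmax ML₀ s 0ℚ (ℕ→ℚ ML₀) 0 0 feasible ℚ.≤-refl (ℚ.≤-reflexive (ℚ.+-identityʳ _)))
    total≤Q)
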